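{- Let $\mathcal M$ be an orientation of the cube matroid $M(C^n)$. Then there is $B\subseteq C^n$ such that the reorientation ${}_{ -B}\mathcal M$ is acyclic and has $(H_n,\emptyset)$ and $(H_{ -n},\emptyset)$ as signed cocircuits.
   Context: $C^n=\{ -1,1\}^n\subseteq\mathbb R^n$, $n\ge1$. $M(C^n)$ is the matroid on $C^n$ of affine dependencies over $\mathbb R$; an orientation is an oriented matroid with this underlying matroid. ${}_{ -B}\mathcal M$ is obtained from $\mathcal M$ by reversing the signs of the elements of $B$ in all signed circuits and cocircuits. An oriented matroid is acyclic if it has no positive signed circuit (one of the form $(X,\emptyset)$). $H_n=\{\mathbf v\in C^n:v_n=1\}$ and $H_{ -n}=\{\mathbf v\in C^n:v_n=-1\}$. -}

module Defs where

open import Data.Bool using (Bool; true; false)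
open import Data.Nat using (ℕ; zero; suc)
open import Data.Fin using (Fin)
open import Data.Integer using (ℤ; +_; -[1+_]; _+_; _*_)
open import Data.List using (List; []; _∷_; map; _++_; foldr)
open import Data.Vec using (Vec; lookup; last) renaming ([] to []ᵥ; _∷_ to _∷ᵥ_)
open import Data.Product using (Σ; ∃; ∃-syntax; _×_; _,_)
open import Data.Sum using (_⊎_)
open import Relation.Binary.PropositionalEquality using (_≡_; _≢_)
open import Relation.Nullary using (¬_)

-- Signs and signed sets over a ground set E
-- A signed set X = (X⁺, X⁻) is encoded as a function E → Sign
-- (X⁺ = elements mapped to pos, X⁻ = elements mapped to neg).

data Sign : Set where
  pos neg zer : Sign

_·_ : Sign → Sign → Sign
pos · pos = pos
pos · neg = neg
neg · pos = neg
neg · neg = pos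
_   · _   = zer

opp : Sign → Sign
opp pos = neg
opp neg = pos
opp zer = zer

SignedSet : Set → Set
SignedSet E = E → Sign

Subset : Set → Set
Subset E = E → Bool

module _ {E : Set} where

  _≐_ : SignedSet E → SignedSet E → Set
  X ≐ Y = ∀ e → X e ≡ Y e

  -ₛ_ : SignedSet E → SignedSet E
  (-ₛ X) e = opp (X e)

  supp : SignedSet E → Subset E
  supp X e with X e
  ... | zer = false
  ... | _   = true

  _⊆_ : Subset E → Subset E → Set
  S ⊆ T = ∀ e → S e ≡ true → T e ≡ true

  _≐ˢ_ : Subset E → Subset E → Set
  S ≐ˢ T = ∀ e → S e ≡ T e

  NonEmpty : SignedSet E → Set
  NonEmpty X = ∃[ e ] X e ≢ zer

  reorient : Subset E → SignedSet E → SignedSet E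
  reorient B X e with B e
  ... | true  = opp (X e)
  ... | false = X e

  _⊥_ : SignedSet E → SignedSet E → Set
  X ⊥ Y = (∀ e → (X e · Y e) ≡ zer)
        ⊎ (∃[ e ] ∃[ f ] ((X e · Y e) ≡ pos × (X f · Y f) ≡ neg))

  Acyclic : (SignedSet E → Set) → Set
  Acyclic 𝒞 = ¬ (∃[ X ] (𝒞 X × (∀ e → X e ≢ neg)))

  -- reoriented circuit family  _{-B}𝒞 = { _{-B}X : X ∈ 𝒞 }
  -- (reorientation is an involution, so  _{-B}X ∈ _{-B}𝒞  iff  X ∈ 𝒞)
  Reorient : Subset E → (SignedSet E → Set) → (SignedSet E → Set)
  Reorient B 𝒞 X = 𝒞 (reorient B X)

  OrthAll : (SignedSet E → Set) → SignedSet E → Set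
  OrthAll 𝒞 Y = ∀ X → 𝒞 X → X ⊥ Y

  IsCocircuit : (SignedSet E → Set) → SignedSet E → Set
  IsCocircuit 𝒞 Y =
    NonEmpty Y × OrthAll 𝒞 Y ×
    (∀ Y' → NonEmpty Y' → OrthAll 𝒞 Y' → supp Y' ⊆ supp Y → supp Y ⊆ supp Y')

record OrientedMatroid (E : Set) : Set₁ where
  field
    circuit    : SignedSet E → Set
    circ-resp  : ∀ {X Y} → X ≐ Y → circuit X → circuit Y
    circ-nonempty : ∀ X → circuit X → NonEmpty X
    circ-neg   : ∀ X → circuit X → circuit (-ₛ X)
    circ-incomp : ∀ X Y → circuit X → circuit Y → supp X ⊆ supp Y →
                  (X ≐ Y) ⊎ (X ≐ (-ₛ Y))
    circ-elim  : ∀ X Y e → circuit X → circuit Y → ¬ (X ≐ (-ₛ Y)) →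
                 X e ≡ pos → Y e ≡ neg →
                 ∃[ Z ] (circuit Z × Z e ≡ zer ×
                   (∀ f → Z f ≡ pos → (X f ≡ pos ⊎ Y f ≡ pos)) ×
                   (∀ f → Z f ≡ neg → (X f ≡ neg ⊎ Y f ≡ neg)))

-- The cube C^n = {-1,1}^n : a point is a Vec Bool n, true ↦ 1, false ↦ -1

Cube : ℕ → Set
Cube n = Vec Bool n

coord : Bool → ℤ
coord true  = + 1
coord false = -[1+ 0 ]

allCube : (n : ℕ) → List (Cube n)
allCube zero    = []ᵥ ∷ []
allCube (suc n) = map (true ∷ᵥ_) (allCube n) ++ map (false ∷ᵥ_) (allCube n)

ΣC : ∀ {n} → (Cube n → ℤ) → ℤ
ΣC {n} f = foldr (λ v acc → f v + acc) (+ 0) (allCube n)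

-- S ⊆ C^n is affinely dependent: some nontrivial coefficient vector
-- supported on S with  Σ λ_v = 0  and  Σ λ_v v = 0.
-- (Coefficients in ℤ; since the points are integral this is equivalent
--  to affine dependence over ℝ.)
AffDep : ∀ {n} → Subset (Cube n) → Set
AffDep {n} S = ∃[ c ]
  ((∀ v → S v ≡ false → c v ≡ + 0) ×
   (∃[ v ] c v ≢ + 0) ×
   ΣC c ≡ + 0 ×
   (∀ (i : Fin n) → ΣC (λ v → c v * coord (lookup v i)) ≡ + 0))

IsCircuitM : ∀ {n} → Subset (Cube n) → Set
IsCircuitM {n} S = AffDep S × (∀ T → T ⊆ S → AffDep T → S ⊆ T)

IsOrientationOfCube : ∀ n → OrientedMatroid (Cube n) → Set
IsOrientationOfCube n 𝓜 =
  (∀ X → circuit X → IsCircuitM (supp X)) ×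
  (∀ S → IsCircuitM S → ∃[ X ] (circuit X × supp X ≐ˢ S))
  where open OrientedMatroid 𝓜

Hpos : ∀ {m} → SignedSet (Cube (suc m))
Hpos v with last v
... | true  = pos
... | false = zer

Hneg : ∀ {m} → SignedSet (Cube (suc m))
Hneg v with last v
... | true  = zer
... | false = pos

{-# OPTIONS --safe #-}
module Submission where

-- H_n is a cocircuit of the cube matroid: an affine dependence cannot be supported in a
-- single point of the hyperplane x_n = 1 (weight it by 1 + x_n), and two points e, f of H_n
-- together with e′, f′, obtained by flipping the last coordinate, form a circuit meeting H_n
-- exactly in {e, f}.  Any such set D of an oriented matroid can be signed.  By strong
-- elimination (derived from weak elimination by induction on |X ∪ Y|) the circuits meeting D
-- exactly in {e, f} all have the same signs at e and f up to negation, so D can be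
-- reoriented to make each of them take opposite signs there.  A circuit nonnegative on D
-- would then shrink by elimination to such a circuit, so every circuit meeting D takes both
-- signs on D: (D, ∅) is orthogonal to all circuits, and the pair circuits make it
-- support-minimal.  H_n and H_{-n} partition C^n, so the two reorientations combine, and a
-- positive circuit, meeting one of them, cannot be orthogonal to it.

open import Defs
open import Data.Bool using (Bool; true; false; not; if_then_else_)
open import Data.Bool.Properties using (not-¬; ¬-not; not-involutive) renaming (_≟_ to _≟ᵇ_)
open import Data.Nat using (ℕ; zero; suc; _≤_; _<_; z≤n; s≤s)
open import Data.Nat.Properties using (≤-refl; <-≤-trans; m≤n⇒m≤1+n)
open import Data.Fin using (Fin; fromℕ) renaming (_≟_ to _≟ᶠ_)
open import Data.Fin.Properties using (¬∀⟶∃¬)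
open import Data.Integer using (ℤ; +_; -[1+_]; _+_; _*_; -_; _-_) renaming (_≟_ to _≟ℤ_)
open import Data.Integer.Properties
  using (+-assoc; +-identityʳ; +-identityˡ; *-identityʳ; *-zeroʳ; *-cancelʳ-≡; neg-involutive)
open import Data.Integer.Tactic.RingSolver using (solve-∀)
open import Data.List using (List; []; _∷_; map; _++_; foldr)
open import Data.List.Membership.Propositional using (_∈_; _∉_; lose)
open import Data.List.Membership.Propositional.Properties using (∈-map⁺; ∈-++⁺ˡ; ∈-++⁺ʳ)
open import Data.List.Relation.Unary.All using (All; []; _∷_)
import Data.List.Relation.Unary.All as All
open import Data.List.Relation.Unary.Any using (here; there; any?; satisfied)
open import Data.List.Relation.Unary.Unique.Propositional using (Unique; []; _∷_)
open import Data.Vec using (lookup; last; updateAt; replicate) renaming ([] to []ᵥ; _∷_ to _∷ᵥ_)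
open import Data.Vec.Properties
  using (≡-dec; ∷-injectiveʳ; lookup∘updateAt; lookup∘updateAt′; updateAt-updateAt-local; updateAt-id;
         tabulate∘lookup; tabulate-cong)
open import Data.Product using (∃; ∃-syntax; _×_; _,_; proj₁; proj₂)
open import Data.Sum using (_⊎_; inj₁; inj₂)
import Data.Sum as Sum
open import Data.Empty using (⊥-elim)
open import Function using (_∘_; case_of_)
open import Level using (0ℓ)
open import Relation.Binary.Definitions using (DecidableEquality)
open import Relation.Binary.PropositionalEquality
  using (_≡_; _≢_; refl; sym; trans; cong; cong₂; subst; module ≡-Reasoning)
open import Relation.Nullary using (¬_; Dec; yes; no; does)
open import Relation.Nullary.Decidable using (_×-dec_; _⊎-dec_; ¬?; map′; dec-true; dec-false; decidable-stable)
open import Relation.Unary using (Pred; Decidable)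

_≟ˢ_ : DecidableEquality Sign
pos ≟ˢ pos = yes refl
neg ≟ˢ neg = yes refl
zer ≟ˢ zer = yes refl
pos ≟ˢ neg = no λ ()
pos ≟ˢ zer = no λ ()
neg ≟ˢ pos = no λ ()
neg ≟ˢ zer = no λ ()
zer ≟ˢ pos = no λ ()
zer ≟ˢ neg = no λ ()

opp-involutive : ∀ s → opp (opp s) ≡ s
opp-involutive pos = refl
opp-involutive neg = refl
opp-involutive zer = refl

opp-≢zer : ∀ {s} → s ≢ zer → opp s ≢ zer
opp-≢zer {s} s≢0 -s≡0 = s≢0 (trans (sym (opp-involutive s)) (cong opp -s≡0))

opp-≢zer⁻¹ : ∀ {s} → opp s ≢ zer → s ≢ zer
opp-≢zer⁻¹ -s≢0 s≡0 = -s≢0 (cong opp s≡0)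

≡opp-sym : ∀ {s t} → s ≡ opp t → t ≡ opp s
≡opp-sym {s} {t} refl = sym (opp-involutive t)

≢zer⇒≢opp : ∀ {s} → s ≢ zer → s ≢ opp s
≢zer⇒≢opp {zer} s≢0 = ⊥-elim (s≢0 refl)
≢zer⇒≢opp {pos} _ ()
≢zer⇒≢opp {neg} _ ()

≢zer⇒≡∨≡opp : ∀ {s t} → s ≢ zer → t ≢ zer → s ≡ t ⊎ s ≡ opp t
≢zer⇒≡∨≡opp {pos} {pos} _ _ = inj₁ refl
≢zer⇒≡∨≡opp {pos} {neg} _ _ = inj₂ refl
≢zer⇒≡∨≡opp {neg} {pos} _ _ = inj₂ refl
≢zer⇒≡∨≡opp {neg} {neg} _ _ = inj₁ refl
≢zer⇒≡∨≡opp {zer} s≢0 _ = ⊥-elim (s≢0 refl)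
≢zer⇒≡∨≡opp {_} {zer} _ t≢0 = ⊥-elim (t≢0 refl)

≢zer∧≢neg⇒≡pos : ∀ {s} → s ≢ zer → s ≢ neg → s ≡ pos
≢zer∧≢neg⇒≡pos {pos} _ _ = refl
≢zer∧≢neg⇒≡pos {neg} _ s≢- = ⊥-elim (s≢- refl)
≢zer∧≢neg⇒≡pos {zer} s≢0 _ = ⊥-elim (s≢0 refl)

≢zer-resp : ∀ {s t} → s ≡ t → s ≢ zer → t ≢ zer
≢zer-resp refl s≢0 = s≢0

·-zeroʳ : ∀ s → s · zer ≡ zer
·-zeroʳ pos = refl
·-zeroʳ neg = refl
·-zeroʳ zer = refl

·-identityʳ : ∀ s → s · pos ≡ s
·-identityʳ pos = refl
·-identityʳ neg = refl
·-identityʳ zer = refl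

·-≢zer : ∀ {s t} → s ≢ zer → t ≢ zer → s · t ≢ zer
·-≢zer {pos} {pos} _ _ ()
·-≢zer {pos} {neg} _ _ ()
·-≢zer {neg} {pos} _ _ ()
·-≢zer {neg} {neg} _ _ ()
·-≢zer {zer} s≢0 _ = ⊥-elim (s≢0 refl)
·-≢zer {pos} {zer} _ t≢0 = ⊥-elim (t≢0 refl)
·-≢zer {neg} {zer} _ t≢0 = ⊥-elim (t≢0 refl)

·-≢zer⁻ʳ : ∀ {s t} → s · t ≢ zer → t ≢ zer
·-≢zer⁻ʳ {s} st≢0 t≡0 = st≢0 (trans (cong (s ·_) t≡0) (·-zeroʳ s))

·-≢neg : ∀ {s t} → s ≢ neg → t ≢ neg → s · t ≢ neg
·-≢neg {pos} {pos} _ _ ()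
·-≢neg {pos} {zer} _ _ ()
·-≢neg {zer} _ _ ()
·-≢neg {neg} s≢- _ = ⊥-elim (s≢- refl)
·-≢neg {pos} {neg} _ t≢- = ⊥-elim (t≢- refl)

oppIf : Bool → Sign → Sign
oppIf true  s = opp s
oppIf false s = s

oppIf-involutive : ∀ b s → oppIf b (oppIf b s) ≡ s
oppIf-involutive true  s = opp-involutive s
oppIf-involutive false s = refl

module _ {E : Set} where

  reorient-oppIf : ∀ (B : Subset E) X e → reorient B X e ≡ oppIf (B e) (X e)
  reorient-oppIf B X e with B e
  ... | true  = refl
  ... | false = refl

  reorient-cancel : ∀ {B C : Subset E} X e → B e ≡ C e → reorient B (reorient C X) e ≡ X e
  reorient-cancel {B} {C} X e B≡C
    rewrite reorient-oppIf B (reorient C X) e | reorient-oppIf C X e | B≡C = oppIf-involutive (C e) (X e)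

  reorient-involutive : ∀ (B : Subset E) X → reorient B (reorient B X) ≐ X
  reorient-involutive B X e = reorient-cancel {B = B} {C = B} X e refl

  reorient-cong : ∀ (B : Subset E) {X Y e} → X e ≡ Y e → reorient B X e ≡ reorient B Y e
  reorient-cong B {e = e} Xe≡Ye with B e
  ... | true  = cong opp Xe≡Ye
  ... | false = Xe≡Ye

  reorient-opp : ∀ (B : Subset E) {X Y e} → X e ≡ opp (Y e) → reorient B X e ≡ opp (reorient B Y e)
  reorient-opp B {e = e} Xe≡-Ye with B e
  ... | true  = cong opp Xe≡-Ye
  ... | false = Xe≡-Ye

  reorient-zer : ∀ (B : Subset E) X e → X e ≡ zer → reorient B X e ≡ zer
  reorient-zer B X e Xe with B e
  ... | true  = cong opp Xe
  ... | false = Xe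

  reorient-≢zer⁻¹ : ∀ (B : Subset E) X e → reorient B X e ≢ zer → X e ≢ zer
  reorient-≢zer⁻¹ B X e rXe≢0 Xe = rXe≢0 (reorient-zer B X e Xe)

  reorient-≢zer : ∀ (B : Subset E) X e → X e ≢ zer → reorient B X e ≢ zer
  reorient-≢zer B X e Xe≢0 with B e
  ... | true  = opp-≢zer Xe≢0
  ... | false = Xe≢0

  ∈supp⁺ : ∀ (X : SignedSet E) {e} → X e ≢ zer → supp X e ≡ true
  ∈supp⁺ X {e} Xe≢0 with X e
  ... | pos = refl
  ... | neg = refl
  ... | zer = ⊥-elim (Xe≢0 refl)

  ∈supp⁻ : ∀ (X : SignedSet E) {e} → supp X e ≡ true → X e ≢ zer
  ∈supp⁻ X {e} e∈X with X e
  ... | pos = λ ()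
  ... | neg = λ ()
  ∈supp⁻ X {e} () | zer

  ∉supp⁺ : ∀ (X : SignedSet E) {e} → X e ≡ zer → supp X e ≡ false
  ∉supp⁺ X {e} Xe with X e
  ... | zer = refl
  ∉supp⁺ X {e} () | pos
  ∉supp⁺ X {e} () | neg

  ∉supp⁻ : ∀ (X : SignedSet E) {e} → supp X e ≡ false → X e ≡ zer
  ∉supp⁻ X {e} e∉X with X e
  ... | zer = refl
  ∉supp⁻ X {e} () | pos
  ∉supp⁻ X {e} () | neg

  Conformal : SignedSet E → SignedSet E → SignedSet E → Set
  Conformal X Y Z = ∀ k → Z k ≢ zer → Z k ≡ X k ⊎ Z k ≡ Y k

  _∪ₛ_ : SignedSet E → SignedSet E → Pred E 0ℓ
  (X ∪ₛ Y) k = X k ≢ zer ⊎ Y k ≢ zer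

  conformal-⊆ : ∀ {X Y Z} → Conformal X Y Z → ∀ k → Z k ≢ zer → (X ∪ₛ Y) k
  conformal-⊆ conf k Zk≢0 with conf k Zk≢0
  ... | inj₁ Zk≡Xk = inj₁ (≢zer-resp Zk≡Xk Zk≢0)
  ... | inj₂ Zk≡Yk = inj₂ (≢zer-resp Zk≡Yk Zk≢0)

  conformal-zer : ∀ {X Y Z k} → Conformal X Y Z → X k ≡ zer → Y k ≡ zer → Z k ≡ zer
  conformal-zer {Z = Z} {k} conf Xk Yk = decidable-stable (Z k ≟ˢ zer) λ Zk≢0 →
    Zk≢0 (Sum.[ (λ Zk≡Xk → trans Zk≡Xk Xk) , (λ Zk≡Yk → trans Zk≡Yk Yk) ]′ (conf k Zk≢0))

  conformal-outside : ∀ {X Y Z k} → Conformal X Y Z → Z k ≢ zer → X k ≡ zer → Z k ≡ Y k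
  conformal-outside {k = k} conf Zk≢0 Xk with conf k Zk≢0
  ... | inj₁ Zk≡Xk = ⊥-elim (Zk≢0 (trans Zk≡Xk Xk))
  ... | inj₂ Zk≡Yk = Zk≡Yk

  conformal-swap : ∀ {X Y Z} → Conformal X Y Z → Conformal Y X Z
  conformal-swap conf k Zk≢0 with conf k Zk≢0
  ... | inj₁ Zk≡Xk = inj₂ Zk≡Xk
  ... | inj₂ Zk≡Yk = inj₁ Zk≡Yk

  conformal-from-signs : ∀ {X Y Z} →
    (∀ f → Z f ≡ pos → X f ≡ pos ⊎ Y f ≡ pos) → (∀ f → Z f ≡ neg → X f ≡ neg ⊎ Y f ≡ neg) →
    Conformal X Y Z
  conformal-from-signs {Z = Z} Z⁺ Z⁻ k Zk≢0 with Z k in Zk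
  ... | pos = Sum.map sym sym (Z⁺ k Zk)
  ... | neg = Sum.map sym sym (Z⁻ k Zk)
  ... | zer = ⊥-elim (Zk≢0 refl)

module Enumeration {E : Set} (elements : List E) (complete : ∀ x → x ∈ elements) where

  ∃? : {P : Pred E 0ℓ} → Decidable P → Dec (∃ P)
  ∃? P? = map′ satisfied (λ (x , Px) → lose (complete x) Px) (any? P? elements)

  private
    count : {P : Pred E 0ℓ} → Decidable P → List E → ℕ
    count P? [] = 0
    count P? (x ∷ xs) with P? x
    ... | yes _ = suc (count P? xs)
    ... | no  _ = count P? xs

    module _ {P Q : Pred E 0ℓ} (P? : Decidable P) (Q? : Decidable Q) (P⊆Q : ∀ x → P x → Q x) where

      count-mono : ∀ xs → count P? xs ≤ count Q? xs
      count-mono [] = z≤n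
      count-mono (x ∷ xs) with P? x | Q? x
      ... | yes _  | yes _  = s≤s (count-mono xs)
      ... | yes Px | no ¬Qx = ⊥-elim (¬Qx (P⊆Q x Px))
      ... | no _   | yes _  = m≤n⇒m≤1+n (count-mono xs)
      ... | no _   | no _   = count-mono xs

      count-< : ∀ {y} xs → y ∈ xs → Q y → ¬ P y → count P? xs < count Q? xs
      count-< (x ∷ xs) (here refl) Qy ¬Py with P? x | Q? x
      ... | yes Py | _      = ⊥-elim (¬Py Py)
      ... | no _   | yes _  = s≤s (count-mono xs)
      ... | no _   | no ¬Qy = ⊥-elim (¬Qy Qy)
      count-< (x ∷ xs) (there y∈xs) Qy ¬Py with P? x | Q? x
      ... | yes _  | yes _  = s≤s (count-< xs y∈xs Qy ¬Py)
      ... | yes Px | no ¬Qx = ⊥-elim (¬Qx (P⊆Q x Px))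
      ... | no _   | yes _  = m≤n⇒m≤1+n (count-< xs y∈xs Qy ¬Py)
      ... | no _   | no _   = count-< xs y∈xs Qy ¬Py

  size : {P : Pred E 0ℓ} → Decidable P → ℕ
  size P? = count P? elements

  size-< : ∀ {P Q : Pred E 0ℓ} (P? : Decidable P) (Q? : Decidable Q) →
           (∀ x → P x → Q x) → ∀ y → Q y → ¬ P y → size P? < size Q?
  size-< P? Q? P⊆Q y = count-< P? Q? P⊆Q elements (complete y)

module StrongElimination {E : Set} (𝓜 : OrientedMatroid E)
                         (elements : List E) (complete : ∀ x → x ∈ elements) where
  open OrientedMatroid 𝓜
  open Enumeration elements complete

  weak-elim : ∀ {X Y e} → circuit X → circuit Y → X e ≡ opp (Y e) → X e ≢ zer → ¬ X ≐ (-ₛ Y) →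
              ∃[ Z ] (circuit Z × Z e ≡ zer × Conformal X Y Z)
  weak-elim {X} {Y} {e} cX cY Xe≡-Ye Xe≢0 X≢-Y with ≢zer⇒≡∨≡opp {t = pos} Xe≢0 (λ ())
  ... | inj₁ Xe≡+ with circ-elim X Y e cX cY X≢-Y Xe≡+ (trans (≡opp-sym Xe≡-Ye) (cong opp Xe≡+))
  ...   | Z , cZ , Ze , Z⁺ , Z⁻ = Z , cZ , Ze , conformal-from-signs Z⁺ Z⁻
  weak-elim {X} {Y} {e} cX cY Xe≡-Ye Xe≢0 X≢-Y | inj₂ Xe≡- 
    with circ-elim Y X e cY cX (λ Y≐-X → X≢-Y (λ k → ≡opp-sym (Y≐-X k)))
                   (trans (≡opp-sym Xe≡-Ye) (cong opp Xe≡-)) Xe≡-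
  ...   | Z , cZ , Ze , Z⁺ , Z⁻ = Z , cZ , Ze , conformal-swap (conformal-from-signs Z⁺ Z⁻)

  ∃-outside : ∀ {X Z e} → circuit X → circuit Z → X e ≢ zer → Z e ≡ zer →
              ∃[ g ] (Z g ≢ zer × X g ≡ zer)
  ∃-outside {X} {Z} {e} cX cZ Xe≢0 Ze with ∃? (λ g → ¬? (Z g ≟ˢ zer) ×-dec (X g ≟ˢ zer))
  ... | yes found = found
  ... | no none = ⊥-elim (differs (circ-incomp Z X cZ cX Z⊆X))
    where
    Z⊆X : supp Z ⊆ supp X
    Z⊆X g g∈Z = ∈supp⁺ X (λ Xg → none (g , ∈supp⁻ Z g∈Z , Xg))
    differs : ¬ (Z ≐ X ⊎ Z ≐ (-ₛ X))
    differs (inj₁ Z≐X)  = Xe≢0 (trans (sym (Z≐X e)) Ze)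
    differs (inj₂ Z≐-X) = opp-≢zer Xe≢0 (trans (sym (Z≐-X e)) Ze)

  ∣_∪_∣ : SignedSet E → SignedSet E → ℕ
  ∣ X ∪ Y ∣ = size (λ k → ¬? (X k ≟ˢ zer) ⊎-dec ¬? (Y k ≟ˢ zer))

  ∣∪∣-< : ∀ {X Y Z W} y → (∀ k → (Z ∪ₛ W) k → (X ∪ₛ Y) k) → (X ∪ₛ Y) y →
          Z y ≡ zer → W y ≡ zer → ∣ Z ∪ W ∣ < ∣ X ∪ Y ∣
  ∣∪∣-< y ZW⊆XY y∈XY Zy Wy = size-< _ _ ZW⊆XY y y∈XY λ where
    (inj₁ Zy≢0) → Zy≢0 Zy
    (inj₂ Wy≢0) → Wy≢0 Wy

  rerouted-⊆ : ∀ {X Y Z₁ W : SignedSet E} → Conformal X Y Z₁ → Conformal Y (-ₛ Z₁) W →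
               ∀ k → (X ∪ₛ W) k → (X ∪ₛ Y) k
  rerouted-⊆ conf₁ confW k (inj₁ Xk≢0) = inj₁ Xk≢0
  rerouted-⊆ conf₁ confW k (inj₂ Wk≢0) with conformal-⊆ confW k Wk≢0
  ... | inj₁ Yk≢0   = inj₂ Yk≢0
  ... | inj₂ -Z₁k≢0 = conformal-⊆ conf₁ k (opp-≢zer⁻¹ -Z₁k≢0)

  Elimination : SignedSet E → SignedSet E → E → E → Set
  Elimination X Y e f = ∃[ Z ] (circuit Z × Z e ≡ zer × Z f ≡ X f × Conformal X Y Z)

  StrongElimBelow : ℕ → Set
  StrongElimBelow n = ∀ {X Y e f} → circuit X → circuit Y → X e ≡ opp (Y e) → X e ≢ zer →
                      X f ≢ zer → Y f ≡ zer → ∣ X ∪ Y ∣ < n → Elimination X Y e f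

  -- Z₁ is a weak elimination of X and Y at e that lost f.  A circuit through f with signs
  -- taken from X, Y and -Z₁ becomes a strong elimination after eliminating, one at a time,
  -- the elements where it has the sign of -Z₁ against Z₁ itself; these unions miss e, so
  -- they stay below ∣ X ∪ Y ∣.
  module Repair {n} (ih : StrongElimBelow n) {X Y Z₁ : SignedSet E} {e f : E}
                (cZ₁ : circuit Z₁) (Z₁e : Z₁ e ≡ zer) (Z₁f : Z₁ f ≡ zer)
                (conf₁ : Conformal X Y Z₁) (Xe≢0 : X e ≢ zer) (Xf≢0 : X f ≢ zer)
                (bound : ∣ X ∪ Y ∣ ≤ n) where

    Admissible : SignedSet E → Set
    Admissible Z = ∀ k → Z k ≢ zer → (Z k ≡ X k ⊎ Z k ≡ Y k) ⊎ Z k ≡ opp (Z₁ k)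

    Candidate : SignedSet E → Set
    Candidate Z = circuit Z × Z e ≡ zer × Z f ≡ X f × Admissible Z

    Bad : SignedSet E → Pred E 0ℓ
    Bad Z k = Z k ≢ zer × Z k ≢ X k × Z k ≢ Y k

    bad? : ∀ Z → Decidable (Bad Z)
    bad? Z k = ¬? (Z k ≟ˢ zer) ×-dec ¬? (Z k ≟ˢ X k) ×-dec ¬? (Z k ≟ˢ Y k)

    admissible-⊆ : ∀ {Z} → Admissible Z → ∀ k → Z k ≢ zer → (X ∪ₛ Y) k
    admissible-⊆ adm k Zk≢0 with adm k Zk≢0
    ... | inj₁ (inj₁ Zk≡Xk) = inj₁ (≢zer-resp Zk≡Xk Zk≢0)
    ... | inj₁ (inj₂ Zk≡Yk) = inj₂ (≢zer-resp Zk≡Yk Zk≢0)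
    ... | inj₂ Zk≡-Z₁k      = conformal-⊆ conf₁ k (opp-≢zer⁻¹ (≢zer-resp Zk≡-Z₁k Zk≢0))

    repair-step : ∀ {Z k} → Candidate Z → Bad Z k →
                  ∃[ Z′ ] (Candidate Z′ × (∀ j → Bad Z′ j → Bad Z j) × Z′ k ≡ zer)
    repair-step {Z} {k} (cZ , Ze , Zf , adm) bad@(Zk≢0 , Zk≢Xk , Zk≢Yk)
      with ih cZ cZ₁ Zk≡-Z₁k Zk≢0 (≢zer-resp (sym Zf) Xf≢0) Z₁f smaller
      where
      Zk≡-Z₁k : Z k ≡ opp (Z₁ k)
      Zk≡-Z₁k with adm k Zk≢0
      ... | inj₁ (inj₁ Zk≡Xk) = ⊥-elim (Zk≢Xk Zk≡Xk)
      ... | inj₁ (inj₂ Zk≡Yk) = ⊥-elim (Zk≢Yk Zk≡Yk)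
      ... | inj₂ Zk≡-Z₁k      = Zk≡-Z₁k
      smaller : ∣ Z ∪ Z₁ ∣ < n
      smaller = <-≤-trans (∣∪∣-< e within (inj₁ Xe≢0) Ze Z₁e) bound
        where
        within : ∀ j → (Z ∪ₛ Z₁) j → (X ∪ₛ Y) j
        within j (inj₁ Zj≢0)  = admissible-⊆ adm j Zj≢0
        within j (inj₂ Z₁j≢0) = conformal-⊆ conf₁ j Z₁j≢0
    ... | Z′ , cZ′ , Z′k , Z′f , conf′ =
      Z′ , (cZ′ , conformal-zer conf′ Ze Z₁e , trans Z′f Zf , adm′) , fewer , Z′k
      where
      adm′ : Admissible Z′
      adm′ j Z′j≢0 with conf′ j Z′j≢0
      ... | inj₂ Z′j≡Z₁j = inj₁ (Sum.map (trans Z′j≡Z₁j) (trans Z′j≡Z₁j) (conf₁ j (≢zer-resp Z′j≡Z₁j Z′j≢0)))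
      ... | inj₁ Z′j≡Zj with adm j (≢zer-resp Z′j≡Zj Z′j≢0)
      ...   | inj₁ ok       = inj₁ (Sum.map (trans Z′j≡Zj) (trans Z′j≡Zj) ok)
      ...   | inj₂ Zj≡-Z₁j  = inj₂ (trans Z′j≡Zj Zj≡-Z₁j)
      fewer : ∀ j → Bad Z′ j → Bad Z j
      fewer j (Z′j≢0 , Z′j≢Xj , Z′j≢Yj) with conf′ j Z′j≢0
      ... | inj₁ Z′j≡Zj = ≢zer-resp Z′j≡Zj Z′j≢0 , (λ eq → Z′j≢Xj (trans Z′j≡Zj eq)) ,
                          (λ eq → Z′j≢Yj (trans Z′j≡Zj eq))
      ... | inj₂ Z′j≡Z₁j with conf₁ j (≢zer-resp Z′j≡Z₁j Z′j≢0)
      ...   | inj₁ Z₁j≡Xj = ⊥-elim (Z′j≢Xj (trans Z′j≡Z₁j Z₁j≡Xj))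
      ...   | inj₂ Z₁j≡Yj = ⊥-elim (Z′j≢Yj (trans Z′j≡Z₁j Z₁j≡Yj))

    repair : ∀ fuel Z → Candidate Z → size (bad? Z) < fuel → Elimination X Y e f
    repair (suc fuel) Z cand@(cZ , Ze , Zf , _) (s≤s few) with ∃? (bad? Z)
    ... | yes (k , bad) with repair-step cand bad
    ...   | Z′ , cand′ , fewer , Z′k =
      repair fuel Z′ cand′ (<-≤-trans (size-< (bad? Z′) (bad? Z) fewer k bad (λ (Z′k≢0 , _) → Z′k≢0 Z′k)) few)
    repair (suc fuel) Z cand@(cZ , Ze , Zf , _) (s≤s few) | no clean = Z , cZ , Ze , Zf , conformal
      where
      conformal : Conformal X Y Z
      conformal k Zk≢0 with Z k ≟ˢ X k | Z k ≟ˢ Y k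
      ... | yes Zk≡Xk | _         = inj₁ Zk≡Xk
      ... | no _      | yes Zk≡Yk = inj₂ Zk≡Yk
      ... | no Zk≢Xk  | no Zk≢Yk  = ⊥-elim (clean (k , Zk≢0 , Zk≢Xk , Zk≢Yk))

  strong-elim-below : ∀ n → StrongElimBelow n
  strong-elim-below zero _ _ _ _ _ _ ()
  strong-elim-below (suc n) {X} {Y} {e} {f} cX cY Xe≡-Ye Xe≢0 Xf≢0 Yf (s≤s bound)
    with weak-elim cX cY Xe≡-Ye Xe≢0 (λ X≐-Y → Xf≢0 (trans (X≐-Y f) (cong opp Yf)))
  ... | Z₁ , cZ₁ , Z₁e , conf₁ with Z₁ f ≟ˢ zer
  ...   | no Z₁f≢0 = Z₁ , cZ₁ , Z₁e , keeps-f , conf₁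
    where
    keeps-f : Z₁ f ≡ X f
    keeps-f with conf₁ f Z₁f≢0
    ... | inj₁ Z₁f≡Xf = Z₁f≡Xf
    ... | inj₂ Z₁f≡Yf = ⊥-elim (Z₁f≢0 (trans Z₁f≡Yf Yf))
  ...   | yes Z₁f with ∃-outside cX cZ₁ Xe≢0 Z₁e
  ...     | g , Z₁g≢0 , Xg
    with strong-elim-below n cY (circ-neg Z₁ cZ₁) Yg≡--Z₁g Yg≢0 Ye≢0 (cong opp Z₁e) smaller₁
    where
    Z₁g≡Yg : Z₁ g ≡ Y g
    Z₁g≡Yg = conformal-outside conf₁ Z₁g≢0 Xg
    Yg≢0 : Y g ≢ zer
    Yg≢0 = ≢zer-resp Z₁g≡Yg Z₁g≢0
    Yg≡--Z₁g : Y g ≡ opp (opp (Z₁ g))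
    Yg≡--Z₁g = trans (sym Z₁g≡Yg) (sym (opp-involutive (Z₁ g)))
    Ye≢0 : Y e ≢ zer
    Ye≢0 = opp-≢zer⁻¹ (≢zer-resp Xe≡-Ye Xe≢0)
    smaller₁ : ∣ Y ∪ (-ₛ Z₁) ∣ < n
    smaller₁ = <-≤-trans (∣∪∣-< f within (inj₁ Xf≢0) Yf (cong opp Z₁f)) bound
      where
      within : ∀ k → (Y ∪ₛ (-ₛ Z₁)) k → (X ∪ₛ Y) k
      within k (inj₁ Yk≢0)   = inj₂ Yk≢0
      within k (inj₂ -Z₁k≢0) = conformal-⊆ conf₁ k (opp-≢zer⁻¹ -Z₁k≢0)
  ...       | W , cW , Wg , We , confW
    with strong-elim-below n cX cW (trans Xe≡-Ye (cong opp (sym We))) Xe≢0 Xf≢0 Wf smaller₂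
    where
    Wf : W f ≡ zer
    Wf = conformal-zer confW Yf (cong opp Z₁f)
    smaller₂ : ∣ X ∪ W ∣ < n
    smaller₂ = <-≤-trans (∣∪∣-< g (rerouted-⊆ conf₁ confW) (conformal-⊆ conf₁ g Z₁g≢0) Xg Wg) bound
  ...         | Z₂ , cZ₂ , Z₂e , Z₂f , conf₂ =
    repair (suc (size (bad? Z₂))) Z₂ (cZ₂ , Z₂e , Z₂f , admissible) ≤-refl
    where
    open Repair (strong-elim-below n) cZ₁ Z₁e Z₁f conf₁ Xe≢0 Xf≢0 bound
    admissible : Admissible Z₂
    admissible k Z₂k≢0 with conf₂ k Z₂k≢0
    ... | inj₁ Z₂k≡Xk = inj₁ (inj₁ Z₂k≡Xk)
    ... | inj₂ Z₂k≡Wk with confW k (≢zer-resp Z₂k≡Wk Z₂k≢0)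
    ...   | inj₁ Wk≡Yk   = inj₁ (inj₂ (trans Z₂k≡Wk Wk≡Yk))
    ...   | inj₂ Wk≡-Z₁k = inj₂ (trans Z₂k≡Wk Wk≡-Z₁k)

  strong-elim : ∀ {X Y e f} → circuit X → circuit Y → X e ≡ opp (Y e) → X e ≢ zer →
                X f ≢ zer → Y f ≡ zer → Elimination X Y e f
  strong-elim cX cY Xe≡-Ye Xe≢0 Xf≢0 Yf = strong-elim-below _ cX cY Xe≡-Ye Xe≢0 Xf≢0 Yf ≤-refl

module _ {E : Set} where

  MeetsExactly : SignedSet E → SignedSet E → E → E → Set
  MeetsExactly H X e f = X e ≢ zer × X f ≢ zer × (∀ k → H k ≢ zer → k ≢ e → k ≢ f → X k ≡ zer)

  NoSingleMeet : (SignedSet E → Set) → SignedSet E → Set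
  NoSingleMeet 𝒞 H = ∀ X → 𝒞 X → ∀ e → H e ≢ zer → X e ≢ zer →
                     ∃[ f ] (f ≢ e × H f ≢ zer × X f ≢ zer)

  PairMeets : (SignedSet E → Set) → SignedSet E → Set
  PairMeets 𝒞 H = ∀ e f → H e ≢ zer → H f ≢ zer → e ≢ f → ∃[ X ] (𝒞 X × MeetsExactly H X e f)

  disjoint⇒⊥ : ∀ {X Y : SignedSet E} → (∀ k → Y k ≢ zer → X k ≡ zer) → X ⊥ Y
  disjoint⇒⊥ {X} {Y} X-off-Y = inj₁ λ k → case Y k ≟ˢ zer of λ where
    (yes Yk)  → trans (cong (X k ·_) Yk) (·-zeroʳ (X k))
    (no Yk≢0) → cong (_· Y k) (X-off-Y k Yk≢0)

  nonneg-⊥-disjoint : ∀ {X Y : SignedSet E} → (∀ k → X k ≢ neg) → (∀ k → Y k ≢ neg) →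
                      X ⊥ Y → ∀ k → X k · Y k ≡ zer
  nonneg-⊥-disjoint X≥0 Y≥0 (inj₁ disjoint) = disjoint
  nonneg-⊥-disjoint X≥0 Y≥0 (inj₂ (_ , j , _ , XYj≡-)) = ⊥-elim (·-≢neg (X≥0 j) (Y≥0 j) XYj≡-)

  ⊥-resp-on-supp : ∀ {X X′ Y : SignedSet E} → (∀ k → Y k ≢ zer → X k ≡ X′ k) → X ⊥ Y → X′ ⊥ Y
  ⊥-resp-on-supp {X} {X′} {Y} X≡X′ = λ where
      (inj₁ disjoint) → inj₁ λ k → trans (sym (same k)) (disjoint k)
      (inj₂ (k , j , +k , -j)) → inj₂ (k , j , trans (sym (same k)) +k , trans (sym (same j)) -j)
    where
    same : ∀ k → X k · Y k ≡ X′ k · Y k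
    same k with Y k ≟ˢ zer
    ... | yes Yk  rewrite Yk = trans (·-zeroʳ (X k)) (sym (·-zeroʳ (X′ k)))
    ... | no Yk≢0 = cong (_· Y k) (X≡X′ k Yk≢0)

  reorient-PairMeets : ∀ (𝓜 : OrientedMatroid E) B {H} → PairMeets (OrientedMatroid.circuit 𝓜) H →
                       PairMeets (Reorient B (OrientedMatroid.circuit 𝓜)) H
  reorient-PairMeets 𝓜 B pairs e f He Hf e≢f with pairs e f He Hf e≢f
  ... | X , cX , Xe≢0 , Xf≢0 , X-elsewhere =
    reorient B X , OrientedMatroid.circ-resp 𝓜 (λ k → sym (reorient-involutive B X k)) cX ,
    reorient-≢zer B X e Xe≢0 , reorient-≢zer B X f Xf≢0 ,
    λ k Hk k≢e k≢f → reorient-zer B X k (X-elsewhere k Hk k≢e k≢f)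

  -- If supp H′ lies in supp H and misses f, the circuit meeting supp H exactly in {e, f}
  -- (e ∈ supp H′) meets supp H′ exactly in e, so it cannot be orthogonal to H′.
  PairMeets⇒supp-minimal : DecidableEquality E → ∀ {𝒞 H} → PairMeets 𝒞 H →
    ∀ H′ → NonEmpty H′ → OrthAll 𝒞 H′ → supp H′ ⊆ supp H → supp H ⊆ supp H′
  PairMeets⇒supp-minimal _≟_ {𝒞} {H} pairs H′ (e , H′e≢0) orth H′⊆H f f∈H with H′ f ≟ˢ zer
  ... | no H′f≢0 = ∈supp⁺ H′ H′f≢0
  ... | yes H′f with pairs e f (∈supp⁻ H (H′⊆H e (∈supp⁺ H′ H′e≢0))) (∈supp⁻ H f∈H) e≢f
    where
    e≢f : e ≢ f
    e≢f refl = H′e≢0 H′f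
  ...   | X , cX , Xe≢0 , _ , X-elsewhere = ⊥-elim (not-orthogonal (orth X cX))
    where
    only-e : ∀ k → X k · H′ k ≢ zer → k ≡ e
    only-e k XH′k≢0 with k ≟ e | k ≟ f
    ... | yes k≡e | _        = k≡e
    ... | no _    | yes refl = ⊥-elim (·-≢zer⁻ʳ XH′k≢0 H′f)
    ... | no k≢e  | no k≢f   = ⊥-elim (XH′k≢0 (cong (_· H′ k) (X-elsewhere k Hk≢0 k≢e k≢f)))
      where
      Hk≢0 : H k ≢ zer
      Hk≢0 = ∈supp⁻ H (H′⊆H k (∈supp⁺ H′ (·-≢zer⁻ʳ XH′k≢0)))
    not-orthogonal : ¬ (X ⊥ H′)
    not-orthogonal (inj₁ disjoint) = ·-≢zer Xe≢0 H′e≢0 (disjoint e)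
    not-orthogonal (inj₂ (k , j , +k , -j))
      with only-e k (≢zer-resp (sym +k) λ ()) | only-e j (≢zer-resp (sym -j) λ ())
    ... | refl | refl with trans (sym +k) -j
    ...   | ()

module Signature {E : Set} (𝓜 : OrientedMatroid E)
                 (elements : List E) (complete : ∀ x → x ∈ elements) (_≟_ : DecidableEquality E)
                 {H : SignedSet E} (H≥0 : ∀ k → H k ≢ neg)
                 (no-single : NoSingleMeet (OrientedMatroid.circuit 𝓜) H)
                 (pairs : PairMeets (OrientedMatroid.circuit 𝓜) H) where
  open OrientedMatroid 𝓜
  open Enumeration elements complete
  open StrongElimination 𝓜 elements complete

  Pair : SignedSet E → E → E → Set
  Pair X e f = circuit X × MeetsExactly H X e f

  Pair-neg : ∀ {X e f} → Pair X e f → Pair (-ₛ X) e f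
  Pair-neg {X} (cX , Xe≢0 , Xf≢0 , X-elsewhere) =
    circ-neg X cX , opp-≢zer Xe≢0 , opp-≢zer Xf≢0 , λ k Hk k≢e k≢f → cong opp (X-elsewhere k Hk k≢e k≢f)

  Pair-sym : ∀ {X e f} → Pair X e f → Pair X f e
  Pair-sym (cX , Xe≢0 , Xf≢0 , X-elsewhere) = cX , Xf≢0 , Xe≢0 , λ k Hk k≢f k≢e → X-elsewhere k Hk k≢e k≢f

  Pair-⊆ : ∀ {X e f k} → Pair X e f → H k ≢ zer → X k ≢ zer → k ≡ e ⊎ k ≡ f
  Pair-⊆ {e = e} {f} {k} (_ , _ , _ , X-elsewhere) Hk Xk≢0 with k ≟ e | k ≟ f
  ... | yes k≡e | _       = inj₁ k≡e
  ... | no _    | yes k≡f = inj₂ k≡f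
  ... | no k≢e  | no k≢f  = ⊥-elim (Xk≢0 (X-elsewhere k Hk k≢e k≢f))

  meets-≤1⇒misses : ∀ {X f} → circuit X → (∀ k → H k ≢ zer → X k ≢ zer → k ≡ f) →
                    ∀ k → H k ≢ zer → X k ≡ zer
  meets-≤1⇒misses {X} cX only-f k Hk = decidable-stable (X k ≟ˢ zer) λ Xk≢0 →
    let j , j≢k , Hj , Xj≢0 = no-single X cX k Hk Xk≢0 in
    j≢k (trans (only-f j Hj Xj≢0) (sym (only-f k Hk Xk≢0)))

  pair-from-trace : ∀ {Z e f} → circuit Z → H e ≢ zer → Z e ≢ zer →
                    (∀ k → H k ≢ zer → k ≢ e → k ≢ f → Z k ≡ zer) → Pair Z e f
  pair-from-trace {Z} {e} {f} cZ He Ze≢0 Z-elsewhere = cZ , Ze≢0 , Zf≢0 , Z-elsewhere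
    where
    Zf≢0 : Z f ≢ zer
    Zf≢0 with no-single Z cZ e He Ze≢0
    ... | j , j≢e , Hj , Zj≢0 with j ≟ f
    ...   | yes refl = Zj≢0
    ...   | no j≢f   = ⊥-elim (Zj≢0 (Z-elsewhere j Hj j≢e j≢f))

  eliminant-misses : ∀ {X Y Z e f} → Pair X e f → Pair Y e f → circuit Z → Z e ≡ zer →
                     Conformal X Y Z → ∀ k → H k ≢ zer → Z k ≡ zer
  eliminant-misses {Z = Z} {e} {f} pX pY cZ Ze conf = meets-≤1⇒misses cZ only-f
    where
    only-f : ∀ k → H k ≢ zer → Z k ≢ zer → k ≡ f
    only-f k Hk Zk≢0 with Sum.[ Pair-⊆ pX Hk , Pair-⊆ pY Hk ]′ (conformal-⊆ conf k Zk≢0)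
    ... | inj₁ refl = ⊥-elim (Zk≢0 Ze)
    ... | inj₂ k≡f  = k≡f

  -- A weak elimination Z₁ of X and Y at e misses supp H, so rerouting Y around an element g
  -- of Z₁ outside X gives a pair circuit W with the signs of Y at e and f and with a smaller
  -- union with X.
  no-mixed-pair-below : ∀ n {X Y e f} → H e ≢ zer → H f ≢ zer → Pair X e f → Pair Y e f →
                        X e ≡ opp (Y e) → X f ≡ Y f → ¬ ∣ X ∪ Y ∣ < n
  no-mixed-pair-below (suc n) {X} {Y} {e} {f} He Hf pX@(cX , Xe≢0 , _ , _) pY@(cY , Ye≢0 , Yf≢0 , Y-elsewhere)
                      Xe≡-Ye Xf≡Yf (s≤s bound)
    with weak-elim cX cY Xe≡-Ye Xe≢0 (λ X≐-Y → ≢zer⇒≢opp Yf≢0 (trans (sym Xf≡Yf) (X≐-Y f)))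
  ... | Z₁ , cZ₁ , Z₁e , conf₁ with ∃-outside cX cZ₁ Xe≢0 Z₁e
  ...   | g , Z₁g≢0 , Xg
    with strong-elim cY (circ-neg Z₁ cZ₁) Yg≡--Z₁g (≢zer-resp Z₁g≡Yg Z₁g≢0) Ye≢0 (cong opp Z₁e)
    where
    Z₁g≡Yg : Z₁ g ≡ Y g
    Z₁g≡Yg = conformal-outside conf₁ Z₁g≢0 Xg
    Yg≡--Z₁g : Y g ≡ opp (opp (Z₁ g))
    Yg≡--Z₁g = trans (sym Z₁g≡Yg) (sym (opp-involutive (Z₁ g)))
  ...     | W , cW , Wg , We , confW =
    no-mixed-pair-below n He Hf pX pW (trans Xe≡-Ye (cong opp (sym We))) (trans Xf≡Yf (sym Wf≡Yf)) smaller
    where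
    -Z₁-misses : ∀ k → H k ≢ zer → opp (Z₁ k) ≡ zer
    -Z₁-misses k Hk = cong opp (eliminant-misses pX pY cZ₁ Z₁e conf₁ k Hk)
    pW : Pair W e f
    pW = pair-from-trace cW He (≢zer-resp (sym We) Ye≢0)
           λ k Hk k≢e k≢f → conformal-zer confW (Y-elsewhere k Hk k≢e k≢f) (-Z₁-misses k Hk)
    Wf≡Yf : W f ≡ Y f
    Wf≡Yf = let (_ , _ , Wf≢0 , _) = pW in conformal-outside (conformal-swap confW) Wf≢0 (-Z₁-misses f Hf)
    smaller : ∣ X ∪ W ∣ < n
    smaller = <-≤-trans (∣∪∣-< g (rerouted-⊆ conf₁ confW) (conformal-⊆ conf₁ g Z₁g≢0) Xg Wg) bound

  pair-signs-agree : ∀ {X Y e f} → H e ≢ zer → H f ≢ zer → Pair X e f → Pair Y e f →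
                     (X e ≡ Y e × X f ≡ Y f) ⊎ (X e ≡ opp (Y e) × X f ≡ opp (Y f))
  pair-signs-agree {X} {Y} {e} {f} He Hf pX@(_ , Xe≢0 , Xf≢0 , _) pY@(_ , Ye≢0 , Yf≢0 , _)
    with ≢zer⇒≡∨≡opp Xe≢0 Ye≢0 | ≢zer⇒≡∨≡opp Xf≢0 Yf≢0
  ... | inj₁ Xe≡Ye   | inj₁ Xf≡Yf   = inj₁ (Xe≡Ye , Xf≡Yf)
  ... | inj₂ Xe≡-Ye  | inj₂ Xf≡-Yf  = inj₂ (Xe≡-Ye , Xf≡-Yf)
  ... | inj₂ Xe≡-Ye  | inj₁ Xf≡Yf   = ⊥-elim (no-mixed-pair-below _ He Hf pX pY Xe≡-Ye Xf≡Yf ≤-refl)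
  ... | inj₁ Xe≡Ye   | inj₂ Xf≡-Yf  =
    ⊥-elim (no-mixed-pair-below _ He Hf pX (Pair-neg pY)
                                (trans Xe≡Ye (sym (opp-involutive (Y e)))) Xf≡-Yf ≤-refl)

  module Reorientation (e₀ : E) (He₀ : H e₀ ≢ zer) where

    opaque
      -- Flip k iff the chosen pair circuit through e₀ and k has equal signs there.
      flip? : ∀ k → Dec (H k ≡ zer) → Dec (e₀ ≡ k) → Bool
      flip? k (no Hk) (no e₀≢k) = let Q = proj₁ (pairs e₀ k He₀ Hk e₀≢k) in does (Q e₀ ≟ˢ Q k)
      flip? k _ _ = false

      F : Subset E
      F k = flip? k (H k ≟ˢ zer) (e₀ ≟ k)

      F-e₀ : F e₀ ≡ false
      F-e₀ = flip?-e₀ (H e₀ ≟ˢ zer) (e₀ ≟ e₀)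
        where
        flip?-e₀ : ∀ d₁ d₂ → flip? e₀ d₁ d₂ ≡ false
        flip?-e₀ (yes _) _         = refl
        flip?-e₀ (no _)  (yes _)   = refl
        flip?-e₀ (no _)  (no e₀≢e₀) = ⊥-elim (e₀≢e₀ refl)

      F-spec : ∀ k → H k ≢ zer → e₀ ≢ k → ∃[ Q ] (Pair Q e₀ k × F k ≡ does (Q e₀ ≟ˢ Q k))
      F-spec k Hk e₀≢k = spec (H k ≟ˢ zer) (e₀ ≟ k)
        where
        spec : ∀ d₁ d₂ → ∃[ Q ] (Pair Q e₀ k × flip? k d₁ d₂ ≡ does (Q e₀ ≟ˢ Q k))
        spec (no Hk′) (no e₀≢k′) = let Q , pQ = pairs e₀ k He₀ Hk′ e₀≢k′ in Q , pQ , refl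
        spec (yes Hk′) _         = ⊥-elim (Hk Hk′)
        spec (no _) (yes e₀≡k)   = ⊥-elim (e₀≢k e₀≡k)

    Balanced : SignedSet E → E → E → Set
    Balanced X e f = reorient F X e ≡ opp (reorient F X f)

    Balanced-sym : ∀ {X e f} → Balanced X e f → Balanced X f e
    Balanced-sym = ≡opp-sym

    Balanced-neg : ∀ {X e f} → Balanced X e f → Balanced (-ₛ X) e f
    Balanced-neg {X} {e} {f} bal = begin
      reorient F (-ₛ X) e        ≡⟨ reorient-opp F refl ⟩
      opp (reorient F X e)       ≡⟨ cong opp bal ⟩
      opp (opp (reorient F X f)) ≡⟨ cong opp (reorient-opp F refl) ⟨
      opp (reorient F (-ₛ X) f)  ∎
      where open ≡-Reasoning

    Balanced-resp : ∀ {X Y e f} → (X e ≡ Y e × X f ≡ Y f) ⊎ (X e ≡ opp (Y e) × X f ≡ opp (Y f)) →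
                    Balanced Y e f → Balanced X e f
    Balanced-resp {X} {Y} {e} {f} (inj₁ (Xe≡Ye , Xf≡Yf)) bal = begin
      reorient F X e       ≡⟨ reorient-cong F Xe≡Ye ⟩
      reorient F Y e       ≡⟨ bal ⟩
      opp (reorient F Y f) ≡⟨ cong opp (reorient-cong F Xf≡Yf) ⟨
      opp (reorient F X f) ∎
      where open ≡-Reasoning
    Balanced-resp {X} {Y} {e} {f} (inj₂ (Xe≡-Ye , Xf≡-Yf)) bal = begin
      reorient F X e             ≡⟨ reorient-opp F Xe≡-Ye ⟩
      opp (reorient F Y e)       ≡⟨ cong opp bal ⟩
      opp (opp (reorient F Y f)) ≡⟨ cong opp (reorient-opp F Xf≡-Yf) ⟨
      opp (reorient F X f)       ∎
      where open ≡-Reasoning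

    base-balanced : ∀ k → H k ≢ zer → e₀ ≢ k → ∃[ Q ] (Pair Q e₀ k × Balanced Q e₀ k)
    base-balanced k Hk e₀≢k with F-spec k Hk e₀≢k
    ... | Q , pQ@(_ , Qe₀≢0 , Qk≢0 , _) , Fk = Q , pQ , (begin
      reorient F Q e₀                          ≡⟨ reorient-oppIf F Q e₀ ⟩
      oppIf (F e₀) (Q e₀)                      ≡⟨ cong (λ b → oppIf b (Q e₀)) F-e₀ ⟩
      Q e₀                                     ≡⟨ opposite-after-flip Qe₀≢0 Qk≢0 ⟩
      opp (oppIf (does (Q e₀ ≟ˢ Q k)) (Q k))   ≡⟨ cong (λ b → opp (oppIf b (Q k))) Fk ⟨
      opp (oppIf (F k) (Q k))                  ≡⟨ cong opp (reorient-oppIf F Q k) ⟨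
      opp (reorient F Q k)                     ∎)
      where
      open ≡-Reasoning
      opposite-after-flip : ∀ {s t} → s ≢ zer → t ≢ zer → s ≡ opp (oppIf (does (s ≟ˢ t)) t)
      opposite-after-flip {s} {t} s≢0 t≢0 with s ≟ˢ t | ≢zer⇒≡∨≡opp s≢0 t≢0
      ... | yes refl | _          = sym (opp-involutive s)
      ... | no s≢t   | inj₁ s≡t   = ⊥-elim (s≢t s≡t)
      ... | no _     | inj₂ s≡-t  = s≡-t

    orient-against : ∀ {X Y : SignedSet E} {e f} → X e ≢ zer → Pair Y e f → Balanced Y e f →
                     ∃[ Y′ ] (Pair Y′ e f × Balanced Y′ e f × X e ≡ opp (Y′ e))
    orient-against {X} {Y} {e} {f} Xe≢0 pY@(_ , Ye≢0 , _) bY with ≢zer⇒≡∨≡opp Xe≢0 Ye≢0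
    ... | inj₁ Xe≡Ye  = -ₛ Y , Pair-neg pY , Balanced-neg bY , trans Xe≡Ye (sym (opp-involutive (Y e)))
    ... | inj₂ Xe≡-Ye = Y , pY , bY , Xe≡-Ye

    -- Eliminating e₀ between the base circuits through e and through f gives a pair circuit
    -- for {e, f} that inherits their (balanced) signs at e and at f.
    balanced-off-base : ∀ {e f} → H e ≢ zer → H f ≢ zer → e ≢ f → e₀ ≢ e → e₀ ≢ f →
                        ∃[ Z ] (Pair Z e f × Balanced Z e f)
    balanced-off-base {e} {f} He Hf e≢f e₀≢e e₀≢f with base-balanced e He e₀≢e | base-balanced f Hf e₀≢f
    ... | Qe , pQe@(cQe , Qee₀≢0 , Qee≢0 , Qe-elsewhere) , bQe | Qf₀ , pQf₀ , bQf₀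
      with orient-against {X = Qe} Qee₀≢0 pQf₀ bQf₀
    ...   | Qf , (cQf , _ , _ , Qf-elsewhere) , bQf , Qee₀≡-Qfe₀
      with strong-elim cQe cQf Qee₀≡-Qfe₀ Qee₀≢0 Qee≢0 (Qf-elsewhere e He (λ e≡e₀ → e₀≢e (sym e≡e₀)) e≢f)
    ...     | Z , cZ , Ze₀ , Ze≡Qee , conf = Z , pZ , bZ
      where
      Z-elsewhere : ∀ k → H k ≢ zer → k ≢ e → k ≢ f → Z k ≡ zer
      Z-elsewhere k Hk k≢e k≢f with k ≟ e₀
      ... | yes refl  = Ze₀
      ... | no k≢e₀   = conformal-zer conf (Qe-elsewhere k Hk k≢e₀ k≢e) (Qf-elsewhere k Hk k≢e₀ k≢f)
      pZ : Pair Z e f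
      pZ = pair-from-trace cZ He (≢zer-resp (sym Ze≡Qee) Qee≢0) Z-elsewhere
      Zf≡Qff : Z f ≡ Qf f
      Zf≡Qff = let (_ , _ , Zf≢0 , _) = pZ in
        conformal-outside conf Zf≢0 (Qe-elsewhere f Hf (λ f≡e₀ → e₀≢f (sym f≡e₀)) (λ f≡e → e≢f (sym f≡e)))
      bZ : Balanced Z e f
      bZ = begin
        reorient F Z e              ≡⟨ reorient-cong F Ze≡Qee ⟩
        reorient F Qe e             ≡⟨ Balanced-sym bQe ⟩
        opp (reorient F Qe e₀)      ≡⟨ cong opp (reorient-opp F Qee₀≡-Qfe₀) ⟩
        opp (opp (reorient F Qf e₀)) ≡⟨ opp-involutive _ ⟩
        reorient F Qf e₀            ≡⟨ bQf ⟩
        opp (reorient F Qf f)       ≡⟨ cong opp (reorient-cong F Zf≡Qff) ⟨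
        opp (reorient F Z f)        ∎
        where open ≡-Reasoning

    balanced-witness : ∀ {e f} → H e ≢ zer → H f ≢ zer → e ≢ f → ∃[ Z ] (Pair Z e f × Balanced Z e f)
    balanced-witness {e} {f} He Hf e≢f = by-cases (e₀ ≟ e) (e₀ ≟ f)
      where
      Witness : E → E → Set
      Witness e f = ∃[ Z ] (Pair Z e f × Balanced Z e f)
      by-cases : Dec (e₀ ≡ e) → Dec (e₀ ≡ f) → Witness e f
      by-cases (yes e₀≡e) _ = subst (λ x → Witness x f) e₀≡e (base-balanced f Hf (subst (_≢ f) (sym e₀≡e) e≢f))
      by-cases (no e₀≢e) (yes e₀≡f) with base-balanced e He e₀≢e
      ... | Z , pZ , bZ = subst (Witness e) e₀≡f (Z , Pair-sym pZ , Balanced-sym bZ)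
      by-cases (no e₀≢e) (no e₀≢f) = balanced-off-base He Hf e≢f e₀≢e e₀≢f

    pair-balanced : ∀ {X e f} → H e ≢ zer → H f ≢ zer → e ≢ f → Pair X e f → Balanced X e f
    pair-balanced He Hf e≢f pX with balanced-witness He Hf e≢f
    ... | Z , pZ , bZ = Balanced-resp (pair-signs-agree He Hf pX pZ) bZ

    ∣_∩H∣ : SignedSet E → ℕ
    ∣ X ∩H∣ = size (λ k → ¬? (H k ≟ˢ zer) ×-dec ¬? (X k ≟ˢ zer))

    ∣∩H∣-< : ∀ {X Z : SignedSet E} y → (∀ k → H k ≢ zer × Z k ≢ zer → H k ≢ zer × X k ≢ zer) →
             H y ≢ zer → X y ≢ zer → Z y ≡ zer → ∣ Z ∩H∣ < ∣ X ∩H∣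
    ∣∩H∣-< y Z⊆X Hy Xy≢0 Zy = size-< _ _ Z⊆X y (Hy , Xy≢0) λ (_ , Zy≢0) → Zy≢0 Zy

    NonnegOnH : SignedSet E → Set
    NonnegOnH X = ∀ k → H k ≢ zer → reorient F X k ≢ neg

    -- Eliminate e between X and the pair circuit through e and f, keeping k; the pair
    -- circuit is positive at f after reorientation, so nonnegativity on supp H survives.
    shrink-nonneg : ∀ {X e f k} → circuit X → H e ≢ zer → H f ≢ zer → e ≢ f →
                    X e ≢ zer → X f ≢ zer → NonnegOnH X → H k ≢ zer → k ≢ e → k ≢ f → X k ≢ zer →
                    ∃[ Z ] (circuit Z × Z k ≢ zer × NonnegOnH Z × ∣ Z ∩H∣ < ∣ X ∩H∣)
    shrink-nonneg {X} {e} {f} {k} cX He Hf e≢f Xe≢0 Xf≢0 X≥0 Hk k≢e k≢f Xk≢0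
      with pairs e f He Hf e≢f
    ... | Y₀ , pY₀ with orient-against {X = X} Xe≢0 pY₀ (pair-balanced He Hf e≢f pY₀)
    ...   | Y , pY@(cY , _ , _ , Y-elsewhere) , bY , Xe≡-Ye
      with strong-elim cX cY Xe≡-Ye Xe≢0 Xk≢0 (Y-elsewhere k Hk k≢e k≢f)
    ...     | Z , cZ , Ze , Zk≡Xk , conf = Z , cZ , ≢zer-resp (sym Zk≡Xk) Xk≢0 , Z≥0 , smaller
      where
      rXe≡+ : reorient F X e ≡ pos
      rXe≡+ = ≢zer∧≢neg⇒≡pos (reorient-≢zer F X e Xe≢0) (X≥0 e He)
      rYf≡+ : reorient F Y f ≡ pos
      rYf≡+ = begin
        reorient F Y f             ≡⟨ opp-involutive _ ⟨
        opp (opp (reorient F Y f)) ≡⟨ cong opp bY ⟨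
        opp (reorient F Y e)       ≡⟨ reorient-opp F Xe≡-Ye ⟨
        reorient F X e             ≡⟨ rXe≡+ ⟩
        pos                        ∎
        where open ≡-Reasoning
      Z-on-H : ∀ {j} → H j ≢ zer → Z j ≢ zer → (Z j ≡ X j) ⊎ (j ≡ e ⊎ j ≡ f) × Z j ≡ Y j
      Z-on-H {j} Hj Zj≢0 with conf j Zj≢0
      ... | inj₁ Zj≡Xj = inj₁ Zj≡Xj
      ... | inj₂ Zj≡Yj = inj₂ (Pair-⊆ pY Hj (≢zer-resp Zj≡Yj Zj≢0) , Zj≡Yj)
      Z≥0 : NonnegOnH Z
      Z≥0 j Hj rZj≡- with Z-on-H Hj (reorient-≢zer⁻¹ F Z j (≢zer-resp (sym rZj≡-) λ ()))
      ... | inj₁ Zj≡Xj              = X≥0 j Hj (trans (reorient-cong F (sym Zj≡Xj)) rZj≡-)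
      ... | inj₂ (inj₁ refl , _)    = reorient-≢zer⁻¹ F Z e (≢zer-resp (sym rZj≡-) λ ()) Ze
      ... | inj₂ (inj₂ refl , Zf≡Yf) with trans (sym rYf≡+) (trans (reorient-cong F (sym Zf≡Yf)) rZj≡-)
      ...   | ()
      smaller : ∣ Z ∩H∣ < ∣ X ∩H∣
      smaller = ∣∩H∣-< e Z∩H⊆X∩H He Xe≢0 Ze
        where
        Z∩H⊆X∩H : ∀ j → H j ≢ zer × Z j ≢ zer → H j ≢ zer × X j ≢ zer
        Z∩H⊆X∩H j (Hj , Zj≢0) with Z-on-H Hj Zj≢0
        ... | inj₁ Zj≡Xj           = Hj , ≢zer-resp Zj≡Xj Zj≢0
        ... | inj₂ (inj₁ refl , _) = Hj , Xe≢0
        ... | inj₂ (inj₂ refl , _) = Hj , Xf≢0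

    pair-not-nonneg : ∀ {X e f} → H e ≢ zer → H f ≢ zer → e ≢ f → Pair X e f → ¬ NonnegOnH X
    pair-not-nonneg {X} {e} {f} He Hf e≢f pX@(_ , Xe≢0 , Xf≢0 , _) X≥0 =
      ≢zer⇒≢opp {pos} (λ ())
        (trans (sym (positive He Xe≢0)) (trans (pair-balanced He Hf e≢f pX) (cong opp (positive Hf Xf≢0))))
      where
      positive : ∀ {k} → H k ≢ zer → X k ≢ zer → reorient F X k ≡ pos
      positive {k} Hk Xk≢0 = ≢zer∧≢neg⇒≡pos (reorient-≢zer F X k Xk≢0) (X≥0 k Hk)

    no-nonneg-circuit-below : ∀ n {X e} → circuit X → H e ≢ zer → X e ≢ zer → ∣ X ∩H∣ < n → ¬ NonnegOnH X
    no-nonneg-circuit-below (suc n) {X} {e} cX He Xe≢0 (s≤s bound) with no-single X cX e He Xe≢0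
    ... | f , f≢e , Hf , Xf≢0 =
      by-cases (∃? (λ k → ¬? (H k ≟ˢ zer) ×-dec ¬? (k ≟ e) ×-dec ¬? (k ≟ f) ×-dec ¬? (X k ≟ˢ zer)))
      where
      by-cases : Dec (∃ λ k → H k ≢ zer × k ≢ e × k ≢ f × X k ≢ zer) → ¬ NonnegOnH X
      by-cases (yes (k , Hk , k≢e , k≢f , Xk≢0)) X≥0 =
        let Z , cZ , Zk≢0 , Z≥0 , smaller =
              shrink-nonneg {X} {e} {f} {k} cX He Hf (f≢e ∘ sym) Xe≢0 Xf≢0 X≥0 Hk k≢e k≢f Xk≢0
        in no-nonneg-circuit-below n cZ Hk Zk≢0 (<-≤-trans smaller bound) Z≥0
      by-cases (no none) = pair-not-nonneg He Hf (f≢e ∘ sym) (cX , Xe≢0 , Xf≢0 , X-elsewhere)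
        where
        X-elsewhere : ∀ k → H k ≢ zer → k ≢ e → k ≢ f → X k ≡ zer
        X-elsewhere k Hk k≢e k≢f =
          decidable-stable (X k ≟ˢ zer) λ Xk≢0 → none (k , Hk , k≢e , k≢f , Xk≢0)

    reoriented-⊥ : ∀ X → circuit X → reorient F X ⊥ H
    reoriented-⊥ X cX with ∃? (λ k → ¬? (H k ≟ˢ zer) ×-dec ¬? (X k ≟ˢ zer))
    ... | no misses = disjoint⇒⊥ λ k Hk →
      reorient-zer F X k (decidable-stable (X k ≟ˢ zer) λ Xk≢0 → misses (k , Hk , Xk≢0))
    ... | yes (e , He , Xe≢0)
      with ∃? (λ k → ¬? (H k ≟ˢ zer) ×-dec (reorient F X k ≟ˢ pos))
         | ∃? (λ k → ¬? (H k ≟ˢ zer) ×-dec (reorient F X k ≟ˢ neg))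
    ...   | yes (k , Hk , rXk≡+) | yes (j , Hj , rXj≡-) = inj₂ (k , j , on-H Hk rXk≡+ , on-H Hj rXj≡-)
      where
      on-H : ∀ {k s} → H k ≢ zer → reorient F X k ≡ s → reorient F X k · H k ≡ s
      on-H {k} Hk rXk≡s =
        trans (cong (reorient F X k ·_) (≢zer∧≢neg⇒≡pos Hk (H≥0 k))) (trans (·-identityʳ _) rXk≡s)
    ...   | _ | no no-neg =
      ⊥-elim (no-nonneg-circuit-below _ cX He Xe≢0 ≤-refl (λ k Hk rXk≡- → no-neg (k , Hk , rXk≡-)))
    ...   | no no-pos | yes _ =
      ⊥-elim (no-nonneg-circuit-below _ (circ-neg X cX) He (opp-≢zer Xe≢0) ≤-refl
        (λ k Hk r-Xk≡- → no-pos (k , Hk , ≡opp-sym (trans (sym r-Xk≡-) (reorient-opp F refl)))))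

  signature : ∃[ F ] (∀ X → circuit X → reorient F X ⊥ H)
  signature with ∃? (λ k → ¬? (H k ≟ˢ zer))
  ... | yes (e₀ , He₀) = F , reoriented-⊥
    where open Reorientation e₀ He₀
  ... | no empty = (λ _ → false) , λ X _ → disjoint⇒⊥ λ k Hk → ⊥-elim (empty (k , Hk))

ΣL : {A : Set} → List A → (A → ℤ) → ℤ
ΣL xs g = foldr (λ v acc → g v + acc) (+ 0) xs

module _ {A : Set} where

  ΣL-cong : ∀ {g h : A → ℤ} xs → All (λ v → g v ≡ h v) xs → ΣL xs g ≡ ΣL xs h
  ΣL-cong [] [] = refl
  ΣL-cong (x ∷ xs) (gx≡hx ∷ rest) = cong₂ _+_ gx≡hx (ΣL-cong xs rest)

  ΣL-zero : ∀ {g : A → ℤ} xs → (∀ v → g v ≡ + 0) → ΣL xs g ≡ + 0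
  ΣL-zero [] g≡0 = refl
  ΣL-zero (x ∷ xs) g≡0 rewrite g≡0 x = trans (+-identityˡ _) (ΣL-zero xs g≡0)

  ΣL-+ : ∀ (g h : A → ℤ) xs → ΣL xs (λ v → g v + h v) ≡ ΣL xs g + ΣL xs h
  ΣL-+ g h [] = refl
  ΣL-+ g h (x ∷ xs) rewrite ΣL-+ g h xs = shuffle (g x) (h x) (ΣL xs g) (ΣL xs h)
    where
    shuffle : ∀ a b c d → (a + b) + (c + d) ≡ (a + c) + (b + d)
    shuffle = solve-∀

  ΣL-*ˡ : ∀ a (g : A → ℤ) xs → ΣL xs (λ v → a * g v) ≡ a * ΣL xs g
  ΣL-*ˡ a g [] = sym (*-zeroʳ a)
  ΣL-*ˡ a g (x ∷ xs) rewrite ΣL-*ˡ a g xs = distrib a (g x) (ΣL xs g)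
    where
    distrib : ∀ a b c → a * b + a * c ≡ a * (b + c)
    distrib = solve-∀

  ΣL-++ : ∀ (g : A → ℤ) xs ys → ΣL (xs ++ ys) g ≡ ΣL xs g + ΣL ys g
  ΣL-++ g [] ys = sym (+-identityˡ _)
  ΣL-++ g (x ∷ xs) ys rewrite ΣL-++ g xs ys = sym (+-assoc (g x) _ _)

  ΣL-map : ∀ {B : Set} (g : B → ℤ) (h : A → B) xs → ΣL (map h xs) g ≡ ΣL xs (g ∘ h)
  ΣL-map g h [] = refl
  ΣL-map g h (x ∷ xs) = cong (λ s → g (h x) + s) (ΣL-map g h xs)

_≟ᶜ_ : ∀ {n} → DecidableEquality (Cube n)
_≟ᶜ_ = ≡-dec _≟ᵇ_

allCube-complete : ∀ n (v : Cube n) → v ∈ allCube n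
allCube-complete zero    []ᵥ          = here refl
allCube-complete (suc n) (true ∷ᵥ v)  = ∈-++⁺ˡ (∈-map⁺ (true ∷ᵥ_) (allCube-complete n v))
allCube-complete (suc n) (false ∷ᵥ v) =
  ∈-++⁺ʳ (map (true ∷ᵥ_) (allCube n)) (∈-map⁺ (false ∷ᵥ_) (allCube-complete n v))

module _ {n : ℕ} where

  ΣC-cong : ∀ {g h : Cube n → ℤ} → (∀ v → g v ≡ h v) → ΣC g ≡ ΣC h
  ΣC-cong g≡h = ΣL-cong (allCube n) (All.universal g≡h (allCube n))

  ΣC-zero : ∀ {g : Cube n → ℤ} → (∀ v → g v ≡ + 0) → ΣC g ≡ + 0
  ΣC-zero = ΣL-zero (allCube n)

  ΣC-+ : ∀ (g h : Cube n → ℤ) → ΣC (λ v → g v + h v) ≡ ΣC g + ΣC h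
  ΣC-+ g h = ΣL-+ g h (allCube n)

  ΣC-*ˡ : ∀ a (g : Cube n → ℤ) → ΣC (λ v → a * g v) ≡ a * ΣC g
  ΣC-*ˡ a g = ΣL-*ˡ a g (allCube n)

ΣC-∷ : ∀ {n} (g : Cube (suc n) → ℤ) → ΣC g ≡ ΣC (g ∘ (true ∷ᵥ_)) + ΣC (g ∘ (false ∷ᵥ_))
ΣC-∷ {n} g = trans (ΣL-++ g (map (true ∷ᵥ_) (allCube n)) _)
                   (cong₂ _+_ (ΣL-map g _ (allCube n)) (ΣL-map g _ (allCube n)))

ΣC-single : ∀ {n} (g : Cube n → ℤ) p → (∀ v → v ≢ p → g v ≡ + 0) → ΣC g ≡ g p
ΣC-single {zero}  g []ᵥ          _   = +-identityʳ (g []ᵥ)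
ΣC-single {suc n} g (true ∷ᵥ p)  off = begin
  ΣC g                                         ≡⟨ ΣC-∷ g ⟩
  ΣC (g ∘ (true ∷ᵥ_)) + ΣC (g ∘ (false ∷ᵥ_))
    ≡⟨ cong₂ _+_ (ΣC-single _ p (λ v v≢p → off _ (v≢p ∘ ∷-injectiveʳ)))
                 (ΣC-zero (λ v → off (false ∷ᵥ v) λ ())) ⟩
  g (true ∷ᵥ p) + + 0                          ≡⟨ +-identityʳ _ ⟩
  g (true ∷ᵥ p)                                ∎
  where open ≡-Reasoning
ΣC-single {suc n} g (false ∷ᵥ p) off = begin
  ΣC g                                         ≡⟨ ΣC-∷ g ⟩
  ΣC (g ∘ (true ∷ᵥ_)) + ΣC (g ∘ (false ∷ᵥ_))
    ≡⟨ cong₂ _+_ (ΣC-zero (λ v → off (true ∷ᵥ v) λ ()))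
                 (ΣC-single _ p (λ v v≢p → off _ (v≢p ∘ ∷-injectiveʳ))) ⟩
  + 0 + g (false ∷ᵥ p)                         ≡⟨ +-identityˡ _ ⟩
  g (false ∷ᵥ p)                               ∎
  where open ≡-Reasoning

module _ {n : ℕ} where

  only : Cube n → (Cube n → ℤ) → Cube n → ℤ
  only p g v = if does (v ≟ᶜ p) then g v else + 0

  without : Cube n → (Cube n → ℤ) → Cube n → ℤ
  without p g v = if does (v ≟ᶜ p) then + 0 else g v

  ΣC-peel : ∀ (g : Cube n → ℤ) p → ΣC g ≡ g p + ΣC (without p g)
  ΣC-peel g p = begin
    ΣC g                                   ≡⟨ ΣC-cong split ⟩
    ΣC (λ v → only p g v + without p g v)  ≡⟨ ΣC-+ (only p g) (without p g) ⟩
    ΣC (only p g) + ΣC (without p g)       ≡⟨ cong (_+ ΣC (without p g)) (ΣC-single (only p g) p only-off) ⟩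
    only p g p + ΣC (without p g)
      ≡⟨ cong (λ b → (if b then g p else + 0) + ΣC (without p g)) (dec-true (p ≟ᶜ p) refl) ⟩
    g p + ΣC (without p g)                 ∎
    where
    open ≡-Reasoning
    split : ∀ v → g v ≡ only p g v + without p g v
    split v with does (v ≟ᶜ p)
    ... | true  = sym (+-identityʳ (g v))
    ... | false = sym (+-identityˡ (g v))
    only-off : ∀ v → v ≢ p → only p g v ≡ + 0
    only-off v v≢p = cong (λ b → if b then g v else + 0) (dec-false (v ≟ᶜ p) v≢p)

  ΣC-supported : ∀ (g : Cube n → ℤ) ps → Unique ps → (∀ v → v ∉ ps → g v ≡ + 0) → ΣC g ≡ ΣL ps g
  ΣC-supported g [] [] off = ΣC-zero (λ v → off v λ ())
  ΣC-supported g (p ∷ ps) (p∉ps ∷ unique) off = begin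
    ΣC g                     ≡⟨ ΣC-peel g p ⟩
    g p + ΣC (without p g)   ≡⟨ cong (λ s → g p + s) (ΣC-supported (without p g) ps unique without-off) ⟩
    g p + ΣL ps (without p g) ≡⟨ cong (λ s → g p + s) (ΣL-cong ps (All.map (λ p≢v → away (p≢v ∘ sym)) p∉ps)) ⟩
    g p + ΣL ps g            ∎
    where
    open ≡-Reasoning
    away : ∀ {v} → v ≢ p → without p g v ≡ g v
    away {v} v≢p = cong (λ b → if b then + 0 else g v) (dec-false (v ≟ᶜ p) v≢p)
    without-off : ∀ v → v ∉ ps → without p g v ≡ + 0
    without-off v v∉ps with v ≟ᶜ p
    ... | yes _   = refl
    ... | no v≢p  = off v λ where
      (here v≡p)    → v≢p v≡p
      (there v∈ps)  → v∉ps v∈ps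

AffineRelation : ∀ {n} → (Cube n → ℤ) → Set
AffineRelation {n} c = ΣC c ≡ + 0 × (∀ (i : Fin n) → ΣC (λ v → c v * coord (lookup v i)) ≡ + 0)

from-does : ∀ {A : Set} (a? : Dec A) → does a? ≡ true → A
from-does (yes a) _ = a

module _ {n : ℕ} where

  support : (Cube n → ℤ) → Subset (Cube n)
  support c v = does (¬? (c v ≟ℤ + 0))

  ∈support⁻ : ∀ c v → support c v ≡ true → c v ≢ + 0
  ∈support⁻ c v = from-does (¬? (c v ≟ℤ + 0))

  ∉support⁻ : ∀ c v → support c v ≡ false → c v ≡ + 0
  ∉support⁻ c v v∉c with c v ≟ℤ + 0
  ∉support⁻ c v () | no _
  ... | yes cv≡0 = cv≡0

circuit-coefficients : ∀ {n} {S : Subset (Cube n)} → IsCircuitM S →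
  ∃[ c ] ((∀ v → S v ≡ true → c v ≢ + 0) × (∀ v → S v ≡ false → c v ≡ + 0) × AffineRelation c)
circuit-coefficients {S = S} ((c , c-off , nonzero , rel) , minimal) = c , c≢0 , c-off , rel
  where
  support⊆S : support c ⊆ S
  support⊆S v v∈c with S v in Sv
  ... | true  = refl
  ... | false = ⊥-elim (∈support⁻ c v v∈c (c-off v Sv))
  c≢0 : ∀ v → S v ≡ true → c v ≢ + 0
  c≢0 v v∈S = ∈support⁻ c v (minimal (support c) support⊆S (c , ∉support⁻ c , nonzero , rel) v v∈S)

coord-not : ∀ b → coord (not b) ≡ - coord b
coord-not true  = refl
coord-not false = refl

coord-cancelʳ : ∀ b x → x * coord b ≡ + 0 → x ≡ + 0
coord-cancelʳ true  x = *-cancelʳ-≡ x (+ 0) (+ 1)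
coord-cancelʳ false x = *-cancelʳ-≡ x (+ 0) -[1+ 0 ]

coord-opposite : ∀ {x y} → x ≢ y → coord x + coord y ≡ + 0
coord-opposite {true}  {false} _ = refl
coord-opposite {false} {true}  _ = refl
coord-opposite {true}  {true}  x≢y = ⊥-elim (x≢y refl)
coord-opposite {false} {false} x≢y = ⊥-elim (x≢y refl)

double≡0⇒≡0 : ∀ x → x + x ≡ + 0 → x ≡ + 0
double≡0⇒≡0 (+ zero) _ = refl
double≡0⇒≡0 (+ suc n) ()
double≡0⇒≡0 -[1+ n ] ()

+≡0⇒≡- : ∀ x y → x + y ≡ + 0 → y ≡ - x
+≡0⇒≡- x y x+y≡0 = begin
  y             ≡⟨ shift x y ⟩
  - x + (x + y) ≡⟨ cong (λ z → - x + z) x+y≡0 ⟩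
  - x + + 0     ≡⟨ +-identityʳ (- x) ⟩
  - x           ∎
  where
  open ≡-Reasoning
  shift : ∀ x y → y ≡ - x + (x + y)
  shift = solve-∀

-- Weighting the relation by coord p_i + coord v_i, which vanishes off the hyperplane
-- v_i = p_i and is ±2 on it, isolates p.
hyperplane-single : ∀ {n} {c : Cube n → ℤ} → AffineRelation c → ∀ i p →
                    (∀ v → v ≢ p → lookup v i ≡ lookup p i → c v ≡ + 0) → c p ≡ + 0
hyperplane-single {c = c} (Σc≡0 , Σcx≡0) i p off = double≡0⇒≡0 (c p) (coord-cancelʳ (lookup p i) _ (begin
  (c p + c p) * u                               ≡⟨ double (c p) u ⟩
  c p * (u + u)                                 ≡⟨ ΣC-single g p g-off ⟨
  ΣC g                                          ≡⟨ ΣC-cong (λ v → expand (c v) u (coord (lookup v i))) ⟩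
  ΣC (λ v → u * c v + c v * coord (lookup v i)) ≡⟨ ΣC-+ (λ v → u * c v) _ ⟩
  ΣC (λ v → u * c v) + ΣC (λ v → c v * coord (lookup v i))
    ≡⟨ cong₂ _+_ (trans (ΣC-*ˡ u c) (trans (cong (u *_) Σc≡0) (*-zeroʳ u))) (Σcx≡0 i) ⟩
  + 0                                           ∎))
  where
  open ≡-Reasoning
  u : ℤ
  u = coord (lookup p i)
  g : Cube _ → ℤ
  g v = c v * (u + coord (lookup v i))
  double : ∀ a b → (a + a) * b ≡ a * (b + b)
  double = solve-∀
  expand : ∀ a b x → a * (b + x) ≡ b * a + a * x
  expand = solve-∀
  g-off : ∀ v → v ≢ p → g v ≡ + 0
  g-off v v≢p with lookup v i ≟ᵇ lookup p i
  ... | yes same  = cong (_* (u + coord (lookup v i))) (off v v≢p same)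
  ... | no differ = trans (cong (c v *_) (coord-opposite (differ ∘ sym))) (*-zeroʳ (c v))

-- The equations of an affine relation (a, b, c, d) on the corners e, e′, f, f′ of a
-- rectangle: the coefficient sum, and the sums against the two coordinates in which the
-- corners differ, with values (s, -s, s, -s) and (t, t, -t, -t).
rectangle-solution : ∀ {a b c d} s t →
  a + (b + (c + (d + + 0))) ≡ + 0 →
  a * coord s + (b * - coord s + (c * coord s + (d * - coord s + + 0))) ≡ + 0 →
  a * coord t + (b * coord t + (c * - coord t + (d * - coord t + + 0))) ≡ + 0 →
  b ≡ - a × c ≡ - a × d ≡ a
rectangle-solution {a} {b} {c} {d} s t E₀ Eₛ Eₜ = b≡-a , c≡-a , d≡a
  where
  Eₛ′ : a - b + c - d ≡ + 0
  Eₛ′ = coord-cancelʳ s _ (trans (factorₛ a b c d (coord s)) Eₛ)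
    where
    factorₛ : ∀ a b c d u → (a - b + c - d) * u ≡ a * u + (b * - u + (c * u + (d * - u + + 0)))
    factorₛ = solve-∀
  Eₜ′ : a + b - c - d ≡ + 0
  Eₜ′ = coord-cancelʳ t _ (trans (factorₜ a b c d (coord t)) Eₜ)
    where
    factorₜ : ∀ a b c d u → (a + b - c - d) * u ≡ a * u + (b * u + (c * - u + (d * - u + + 0)))
    factorₜ = solve-∀
  a+c≡0 : a + c ≡ + 0
  a+c≡0 = double≡0⇒≡0 _ (trans (sum a b c d) (cong₂ _+_ E₀ Eₛ′))
    where
    sum : ∀ a b c d → (a + c) + (a + c) ≡ (a + (b + (c + (d + + 0)))) + (a - b + c - d)
    sum = solve-∀
  a+b≡0 : a + b ≡ + 0
  a+b≡0 = double≡0⇒≡0 _ (trans (sum a b c d) (cong₂ _+_ E₀ Eₜ′))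
    where
    sum : ∀ a b c d → (a + b) + (a + b) ≡ (a + (b + (c + (d + + 0)))) + (a + b - c - d)
    sum = solve-∀
  b+d≡0 : b + d ≡ + 0
  b+d≡0 = double≡0⇒≡0 _ (trans (difference a b c d) (cong₂ _-_ E₀ Eₛ′))
    where
    difference : ∀ a b c d → (b + d) + (b + d) ≡ (a + (b + (c + (d + + 0)))) - (a - b + c - d)
    difference = solve-∀
  b≡-a : b ≡ - a
  b≡-a = +≡0⇒≡- a b a+b≡0
  c≡-a : c ≡ - a
  c≡-a = +≡0⇒≡- a c a+c≡0
  d≡a : d ≡ a
  d≡a = trans (+≡0⇒≡- b d b+d≡0) (trans (cong -_ b≡-a) (neg-involutive a))

flipAt : ∀ {n} → Fin n → Cube n → Cube n
flipAt i v = updateAt v i not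

module _ {n : ℕ} (i : Fin n) where

  lookup-flipAt : ∀ v → lookup (flipAt i v) i ≡ not (lookup v i)
  lookup-flipAt v = lookup∘updateAt i v

  lookup-flipAt′ : ∀ {j} v → j ≢ i → lookup (flipAt i v) j ≡ lookup v j
  lookup-flipAt′ {j} v j≢i = lookup∘updateAt′ j i j≢i v

  flipAt-involutive : ∀ v → flipAt i (flipAt i v) ≡ v
  flipAt-involutive v =
    trans (updateAt-updateAt-local i {h = λ x → x} v (not-involutive (lookup v i))) (updateAt-id i v)

  flipAt-≢ : ∀ v → flipAt i v ≢ v
  flipAt-≢ v eq = not-¬ refl (trans (cong (λ w → lookup w i) (sym eq)) (lookup-flipAt v))

  flipAt-side : ∀ {v w} → lookup v i ≡ lookup w i → flipAt i v ≢ w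
  flipAt-side {v} same eq = not-¬ refl (trans same (trans (cong (λ x → lookup x i) (sym eq)) (lookup-flipAt v)))

module Rectangle {n : ℕ} (i : Fin n) {e f : Cube n} (e≢f : e ≢ f) (e≐f : lookup e i ≡ lookup f i) where

  e′ f′ : Cube n
  e′ = flipAt i e
  f′ = flipAt i f

  corners : List (Cube n)
  corners = e ∷ e′ ∷ f ∷ f′ ∷ []

  InRectangle : Subset (Cube n)
  InRectangle v = does (any? (v ≟ᶜ_) corners)

  e≢e′ : e ≢ e′
  e≢e′ = flipAt-≢ i e ∘ sym
  e≢f′ : e ≢ f′
  e≢f′ = flipAt-side i (sym e≐f) ∘ sym
  e′≢f : e′ ≢ f
  e′≢f = flipAt-side i e≐f
  e′≢f′ : e′ ≢ f′
  e′≢f′ eq = e≢f (trans (sym (flipAt-involutive i e)) (trans (cong (flipAt i) eq) (flipAt-involutive i f)))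
  f≢f′ : f ≢ f′
  f≢f′ = flipAt-≢ i f ∘ sym

  corners-unique : Unique corners
  corners-unique = (e≢e′ ∷ e≢f ∷ e≢f′ ∷ []) ∷ (e′≢f ∷ e′≢f′ ∷ []) ∷ (f≢f′ ∷ []) ∷ [] ∷ []

  ∈corners⇒InRectangle : ∀ {v} → v ∈ corners → InRectangle v ≡ true
  ∈corners⇒InRectangle {v} = dec-true (any? (v ≟ᶜ_) corners)

  ∉corners⇒∉InRectangle : ∀ {v} → v ∉ corners → InRectangle v ≡ false
  ∉corners⇒∉InRectangle {v} = dec-false (any? (v ≟ᶜ_) corners)

  InRectangle⇒∈corners : ∀ {v} → InRectangle v ≡ true → v ∈ corners
  InRectangle⇒∈corners {v} = from-does (any? (v ≟ᶜ_) corners)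

  δ : Cube n → Cube n → ℤ
  δ p v = if does (v ≟ᶜ p) then + 1 else + 0

  δ-refl : ∀ p → δ p p ≡ + 1
  δ-refl p = cong (λ b → if b then + 1 else + 0) (dec-true (p ≟ᶜ p) refl)

  δ-≢ : ∀ {p v} → v ≢ p → δ p v ≡ + 0
  δ-≢ {p} {v} v≢p = cong (λ b → if b then + 1 else + 0) (dec-false (v ≟ᶜ p) v≢p)

  relation : Cube n → ℤ
  relation v = δ e v - δ e′ v - δ f v + δ f′ v

  relation-at : ∀ v {a b c d} → δ e v ≡ a → δ e′ v ≡ b → δ f v ≡ c → δ f′ v ≡ d → relation v ≡ a - b - c + d
  relation-at v refl refl refl refl = refl

  relation-off : ∀ {v} → v ∉ corners → relation v ≡ + 0
  relation-off {v} v∉ = relation-at v (δ-≢ (v∉ ∘ here)) (δ-≢ (v∉ ∘ there ∘ here))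
                                (δ-≢ (v∉ ∘ there ∘ there ∘ here)) (δ-≢ (v∉ ∘ there ∘ there ∘ there ∘ here))

  relation-e : relation e ≡ + 1
  relation-e = relation-at e (δ-refl e) (δ-≢ e≢e′) (δ-≢ e≢f) (δ-≢ e≢f′)

  ΣC-relation : ∀ (g : Cube n → ℤ) → ΣC (λ v → relation v * g v) ≡ g e - g e′ - g f + g f′
  ΣC-relation g =
    trans (ΣC-supported (λ v → relation v * g v) corners corners-unique (λ v v∉ → cong (_* g v) (relation-off v∉)))
    (alternate relation-e
               (relation-at e′ (δ-≢ (e≢e′ ∘ sym)) (δ-refl e′) (δ-≢ e′≢f) (δ-≢ e′≢f′))
               (relation-at f (δ-≢ (e≢f ∘ sym)) (δ-≢ (e′≢f ∘ sym)) (δ-refl f) (δ-≢ f≢f′))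
               (relation-at f′ (δ-≢ (e≢f′ ∘ sym)) (δ-≢ (e′≢f′ ∘ sym)) (δ-≢ (f≢f′ ∘ sym)) (δ-refl f′)))
    where
    alternate : ∀ {ra rb rc rd} → ra ≡ + 1 → rb ≡ - + 1 → rc ≡ - + 1 → rd ≡ + 1 →
                ra * g e + (rb * g e′ + (rc * g f + (rd * g f′ + + 0))) ≡ g e - g e′ - g f + g f′
    alternate refl refl refl refl = identity (g e) (g e′) (g f) (g f′)
      where
      identity : ∀ a b c d → + 1 * a + (- + 1 * b + (- + 1 * c + (+ 1 * d + + 0))) ≡ a - b - c + d
      identity = solve-∀

  coordinates : ∀ j → (lookup e′ j ≡ lookup e j × lookup f′ j ≡ lookup f j)
                    ⊎ (lookup f j ≡ lookup e j × lookup f′ j ≡ lookup e′ j)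
  coordinates j with j ≟ᶠ i
  ... | no j≢i   = inj₁ (lookup-flipAt′ i e j≢i , lookup-flipAt′ i f j≢i)
  ... | yes refl =
    inj₂ (sym e≐f , trans (lookup-flipAt i f) (trans (cong not (sym e≐f)) (sym (lookup-flipAt i e))))

  relation-affine : AffineRelation relation
  relation-affine = trans (ΣC-cong (λ v → sym (*-identityʳ (relation v)))) (ΣC-relation (λ _ → + 1)) , coordinate
    where
    coordinate : ∀ j → ΣC (λ v → relation v * coord (lookup v j)) ≡ + 0
    coordinate j with coordinates j | ΣC-relation (λ v → coord (lookup v j))
    ... | inj₁ (e′≐e , f′≐f) | Σ rewrite e′≐e | f′≐f = trans Σ (pairs (coord (lookup e j)) (coord (lookup f j)))
      where
      pairs : ∀ x y → x - x - y + y ≡ + 0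
      pairs = solve-∀
    ... | inj₂ (f≐e , f′≐e′) | Σ rewrite f≐e | f′≐e′ = trans Σ (pairs (coord (lookup e j)) (coord (lookup e′ j)))
      where
      pairs : ∀ x y → x - y - x + y ≡ + 0
      pairs = solve-∀

  dependent : AffDep InRectangle
  dependent = relation , off , (e , λ eq → +1≢0 (trans (sym relation-e) eq)) , relation-affine
    where
    +1≢0 : + 1 ≢ + 0
    +1≢0 ()
    off : ∀ v → InRectangle v ≡ false → relation v ≡ + 0
    off v v∉R = relation-off {v} λ v∈ → true≢false (trans (sym (∈corners⇒InRectangle v∈)) v∉R)
      where
      true≢false : true ≢ false
      true≢false ()

  corner-coefficient : ∀ {c} → (∀ w → w ∉ corners → c w ≡ + 0) → AffineRelation c →
                       ∀ {w} → w ∈ corners → c w ≡ c e ⊎ c w ≡ - c e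
  corner-coefficient {c} c-off (Σc≡0 , Σcx≡0) = λ where
      (here refl)                         → inj₁ refl
      (there (here refl))                 → inj₂ (proj₁ solution)
      (there (there (here refl)))         → inj₂ (proj₁ (proj₂ solution))
      (there (there (there (here refl)))) → inj₁ (proj₂ (proj₂ solution))
    where
    equation-at : ∀ j {p q r s} → coord (lookup e j) ≡ p → coord (lookup e′ j) ≡ q →
                  coord (lookup f j) ≡ r → coord (lookup f′ j) ≡ s →
                  c e * p + (c e′ * q + (c f * r + (c f′ * s + + 0))) ≡ + 0
    equation-at j refl refl refl refl = trans (sym (ΣC-supported _ corners corners-unique off)) (Σcx≡0 j)
      where
      off : ∀ w → w ∉ corners → c w * coord (lookup w j) ≡ + 0
      off w w∉ = cong (_* coord (lookup w j)) (c-off w w∉)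
    differing : ∃[ j ] (lookup e j ≢ lookup f j)
    differing = ¬∀⟶∃¬ n _ (λ j → lookup e j ≟ᵇ lookup f j) (e≢f ∘ lookup-ext)
      where
      lookup-ext : (∀ j → lookup e j ≡ lookup f j) → e ≡ f
      lookup-ext same = trans (sym (tabulate∘lookup e)) (trans (tabulate-cong same) (tabulate∘lookup f))
    solution : c e′ ≡ - c e × c f ≡ - c e × c f′ ≡ c e
    solution with differing
    ... | j , differ = rectangle-solution (lookup e i) (lookup e j)
      (trans (sym (ΣC-supported c corners corners-unique c-off)) Σc≡0)
      (equation-at i refl (trans (cong coord (lookup-flipAt i e)) (coord-not _)) (cong coord (sym e≐f))
                          (trans (cong coord (trans (lookup-flipAt i f) (cong not (sym e≐f)))) (coord-not _)))
      (equation-at j refl (cong coord (lookup-flipAt′ i e j≢i))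
                          (trans (cong coord f≐not-e) (coord-not _))
                          (trans (cong coord (trans (lookup-flipAt′ i f j≢i) f≐not-e)) (coord-not _)))
      where
      j≢i : j ≢ i
      j≢i refl = differ e≐f
      f≐not-e : lookup f j ≡ not (lookup e j)
      f≐not-e = ¬-not (differ ∘ sym)

  minimal : ∀ T → T ⊆ InRectangle → AffDep T → InRectangle ⊆ T
  minimal T T⊆R (c , c-off , (v₀ , cv₀≢0) , affine) v v∈R with T v in Tv
  ... | true  = refl
  ... | false = ⊥-elim (cv₀≢0 (c≡0 v₀))
    where
    c-off-corners : ∀ w → w ∉ corners → c w ≡ + 0
    c-off-corners w w∉ with T w in Tw
    ... | true  = ⊥-elim (w∉ (InRectangle⇒∈corners (T⊆R w Tw)))
    ... | false = c-off w Tw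
    ce≡0 : c e ≡ + 0
    ce≡0 with corner-coefficient c-off-corners affine (InRectangle⇒∈corners v∈R)
    ... | inj₁ cv≡ce  = trans (sym cv≡ce) (c-off v Tv)
    ... | inj₂ cv≡-ce = trans (sym (neg-involutive (c e))) (cong -_ (trans (sym cv≡-ce) (c-off v Tv)))
    c≡0 : ∀ w → c w ≡ + 0
    c≡0 w with any? (w ≟ᶜ_) corners
    ... | no w∉ = c-off-corners w w∉
    ... | yes w∈ with corner-coefficient c-off-corners affine w∈
    ...   | inj₁ cw≡ce  = trans cw≡ce ce≡0
    ...   | inj₂ cw≡-ce = trans cw≡-ce (cong -_ ce≡0)

  rectangle-circuit : IsCircuitM InRectangle
  rectangle-circuit = dependent , minimal

lookup-fromℕ : ∀ {m} (v : Cube (suc m)) → lookup v (fromℕ m) ≡ last v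
lookup-fromℕ {zero}  (x ∷ᵥ []ᵥ) = refl
lookup-fromℕ {suc m} (x ∷ᵥ v)  = lookup-fromℕ v

last-replicate : ∀ m (b : Bool) → last (replicate (suc m) b) ≡ b
last-replicate zero    b = refl
last-replicate (suc m) b = last-replicate m b

module _ {m : ℕ} where

  H : Bool → SignedSet (Cube (suc m))
  H true  = Hpos
  H false = Hneg

  H-nonneg : ∀ b v → H b v ≢ neg
  H-nonneg true  v with last v
  ... | true  = λ ()
  ... | false = λ ()
  H-nonneg false v with last v
  ... | true  = λ ()
  ... | false = λ ()

  H-≢zer : ∀ b {v} → last v ≡ b → H b v ≢ zer
  H-≢zer true  {v} lv with last v | lv
  ... | true  | refl = λ ()
  H-≢zer false {v} lv with last v | lv
  ... | false | refl = λ ()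

  H-≢zer⁻¹ : ∀ b {v} → H b v ≢ zer → last v ≡ b
  H-≢zer⁻¹ true  {v} Hv≢0 with last v
  ... | true  = refl
  ... | false = ⊥-elim (Hv≢0 refl)
  H-≢zer⁻¹ false {v} Hv≢0 with last v
  ... | true  = ⊥-elim (Hv≢0 refl)
  ... | false = refl

  H-nonempty : ∀ b → NonEmpty (H b)
  H-nonempty b = replicate (suc m) b , H-≢zer b (last-replicate m b)

module CubeOrientation {m : ℕ} (𝓜 : OrientedMatroid (Cube (suc m)))
                       (orientation : IsOrientationOfCube (suc m) 𝓜) where
  open OrientedMatroid 𝓜
  open Enumeration (allCube (suc m)) (allCube-complete (suc m))

  same-side : ∀ b {v w} → last v ≡ b → last w ≡ b → lookup v (fromℕ m) ≡ lookup w (fromℕ m)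
  same-side b {v} {w} lv lw = trans (lookup-fromℕ v) (trans lv (trans (sym lw) (sym (lookup-fromℕ w))))

  no-single-meet : ∀ b → NoSingleMeet circuit (H b)
  no-single-meet b X cX e He Xe≢0 with ∃? (λ f → ¬? (f ≟ᶜ e) ×-dec ¬? (H b f ≟ˢ zer) ×-dec ¬? (X f ≟ˢ zer))
  ... | yes found = found
  ... | no none with circuit-coefficients (proj₁ orientation X cX)
  ...   | c , c≢0 , c-off , affine = ⊥-elim (c≢0 e (∈supp⁺ X Xe≢0) (hyperplane-single affine (fromℕ m) e alone))
    where
    alone : ∀ v → v ≢ e → lookup v (fromℕ m) ≡ lookup e (fromℕ m) → c v ≡ + 0
    alone v v≢e same = c-off v (∉supp⁺ X Xv≡0)
      where
      Hv≢0 : H b v ≢ zer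
      Hv≢0 = H-≢zer b (trans (sym (lookup-fromℕ v)) (trans same (trans (lookup-fromℕ e) (H-≢zer⁻¹ b He))))
      Xv≡0 : X v ≡ zer
      Xv≡0 = decidable-stable (X v ≟ˢ zer) λ Xv≢0 → none (v , v≢e , Hv≢0 , Xv≢0)

  pair-meets : ∀ b → PairMeets circuit (H b)
  pair-meets b e f He Hf e≢f = meets (proj₂ orientation InRectangle rectangle-circuit)
    where
    open Rectangle (fromℕ m) e≢f (same-side b (H-≢zer⁻¹ b He) (H-≢zer⁻¹ b Hf))
    meets : ∃[ X ] (circuit X × supp X ≐ˢ InRectangle) → ∃[ X ] (circuit X × MeetsExactly (H b) X e f)
    meets (X , cX , X≐R) = X , cX , on-corner (here refl) , on-corner (there (there (here refl))) , X-elsewhere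
      where
      on-corner : ∀ {v} → v ∈ corners → X v ≢ zer
      on-corner v∈ = ∈supp⁻ X (trans (X≐R _) (∈corners⇒InRectangle v∈))
      X-elsewhere : ∀ k → H b k ≢ zer → k ≢ e → k ≢ f → X k ≡ zer
      X-elsewhere k Hk k≢e k≢f = ∉supp⁻ X (trans (X≐R k) (∉corners⇒∉InRectangle k∉))
        where
        flipped-off-side : ∀ {v} → H b v ≢ zer → flipAt (fromℕ m) v ≢ k
        flipped-off-side Hv = flipAt-side (fromℕ m) (same-side b (H-≢zer⁻¹ b Hv) (H-≢zer⁻¹ b Hk))
        k∉ : k ∉ corners
        k∉ (here k≡e)                          = k≢e k≡e
        k∉ (there (here k≡e′))                 = flipped-off-side He (sym k≡e′)
        k∉ (there (there (here k≡f)))          = k≢f k≡f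
        k∉ (there (there (there (here k≡f′)))) = flipped-off-side Hf (sym k≡f′)

lemma3p1 : (m : ℕ) (𝓜 : OrientedMatroid (Cube (suc m))) →
    IsOrientationOfCube (suc m) 𝓜 →
    ∃[ B ] (Acyclic (Reorient B (OrientedMatroid.circuit 𝓜)) ×
            IsCocircuit (Reorient B (OrientedMatroid.circuit 𝓜)) Hpos ×
            IsCocircuit (Reorient B (OrientedMatroid.circuit 𝓜)) Hneg)
lemma3p1 m 𝓜 orientation = B , acyclic , cocircuit true , cocircuit false
  where
  open OrientedMatroid 𝓜
  open CubeOrientation 𝓜 orientation
  signing : ∀ b → ∃[ F ] (∀ X → circuit X → reorient F X ⊥ H b)
  signing b = Signature.signature 𝓜 (allCube (suc m)) (allCube-complete (suc m)) _≟ᶜ_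
                                  (H-nonneg b) (no-single-meet b) (pair-meets b)
  B : Subset (Cube (suc m))
  B v = proj₁ (signing (last v)) v
  B-on-side : ∀ b {k} → H b k ≢ zer → proj₁ (signing b) k ≡ B k
  B-on-side b {k} Hk = cong (λ b′ → proj₁ (signing b′) k) (sym (H-≢zer⁻¹ b Hk))
  orthogonal : ∀ b X → Reorient B circuit X → X ⊥ H b
  orthogonal b X cX =
    ⊥-resp-on-supp (λ k Hk → reorient-cancel {B = proj₁ (signing b)} {C = B} X k (B-on-side b Hk))
                   (proj₂ (signing b) (reorient B X) cX)
  acyclic : Acyclic (Reorient B circuit)
  acyclic (X , cX , X≥0) =
    let e , rXe≢0 = circ-nonempty (reorient B X) cX in
    ·-≢zer (reorient-≢zer⁻¹ B X e rXe≢0) (H-≢zer (last e) refl)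
           (nonneg-⊥-disjoint X≥0 (H-nonneg (last e)) (orthogonal (last e) X cX) e)
  cocircuit : ∀ b → IsCocircuit (Reorient B circuit) (H b)
  cocircuit b =
    H-nonempty b , orthogonal b , PairMeets⇒supp-minimal _≟ᶜ_ (reorient-PairMeets 𝓜 B (pair-meets b))
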